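{- Let $k\ge 2$ be an integer and let $A_k=(a_{ij})$ be the $k\times k$ real matrix with entries $a_{ij}=\frac{1}{2}|i-j|$ for $1\le i,j\le k$. Let $C_k(\lambda)=\det(A_k-\lambda I_k)$ be its characteristic polynomial. Then for every nonzero $\lambda$, $$C_k(\lambda)=(-1)^k\lambda^k\left(1-\frac{k}{4}\sum_{j=1}^{k-1}\frac{j}{j+1}\binom{k+j}{2j+1}\lambda^{ -j-1}\right).$$ Equivalently, $C_k(\lambda)=(-1)^k\lambda^k-(-1)^k\frac{k}{4}\sum_{j=1}^{k-1}\frac{j}{j+1}\binom{k+j}{2j+1}\lambda^{k-j-1}$ as polynomials in $\lambda$.
   Context: $I_k$ denotes the $k\times k$ identity matrix.
   Formalization: The variable λ ranges over the nonzero rationals, and the determinant defining $C_k(\lambda)$ is taken over ℚ. -}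

module Defs where

open import Data.Nat as ℕ using (ℕ; zero; suc; ∣_-_∣)
open import Data.Fin using (Fin; zero; suc; toℕ; punchIn)
open import Data.Integer using (+_)
open import Relation.Nullary using (yes; no)
open import Data.Rational using (ℚ; 0ℚ; 1ℚ; _+_; _*_; _-_; -_; _/_; 1/_; NonZero)

Matrix : ℕ → Set
Matrix n = Fin n → Fin n → ℚ

sumFin : (n : ℕ) → (Fin n → ℚ) → ℚ
sumFin zero    f = 0ℚ
sumFin (suc n) f = f zero + sumFin n (λ i → f (suc i))

sum1 : ℕ → (ℕ → ℚ) → ℚ
sum1 zero    f = 0ℚ
sum1 (suc n) f = sum1 n f + f (suc n)

pow : ℚ → ℕ → ℚ
pow x zero    = 1ℚ
pow x (suc n) = x * pow x n

sgn : ℕ → ℚ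
sgn n = pow (- 1ℚ) n

det : (n : ℕ) → Matrix n → ℚ
det zero    M = 1ℚ
det (suc n) M =
  sumFin (suc n) (λ j → sgn (toℕ j) * (M zero j * det n (λ r c → M (suc r) (punchIn j c))))

I : (n : ℕ) → Matrix n
I n i j with toℕ i ℕ.≟ toℕ j
... | yes _ = 1ℚ
... | no _  = 0ℚ

-- A_k with entries a_ij = |i - j| / 2 (0-based indices; |i-j| is index-shift invariant)
A : (k : ℕ) → Matrix k
A k i j = (+ ∣ toℕ i - toℕ j ∣) / 2

subScalar : (n : ℕ) → Matrix n → ℚ → Matrix n
subScalar n M t i j = M i j - t * I n i j

charPoly : (k : ℕ) → ℚ → ℚ
charPoly k t = det k (subScalar k (A k) t)

ℕ→ℚ : ℕ → ℚ
ℕ→ℚ n = (+ n) / 1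

-- Subtracting from every column but the first its left neighbour, and then doing the same
-- once more from the third column on, leaves the determinant of A_k - tI unchanged and turns
-- it into a matrix whose first two columns are the first column of A_k - tI and the difference
-- of its first two columns, while every later column j is the band (-t, 1 + 2t, -t) in rows
-- j - 2, j - 1, j.
-- Expanding along the first row only ever produces matrices of the same shape, and when the
-- free columns have the form a + b i + g[i = 0] their determinants are linear combinations of
-- three sequences G, G', H. These are explicit in T_k, S_k, where T_(k+1) = t T_k + S_k and
-- S_(k+1) = t S_k + T_(k+1); this yields C_k(t) = (-t)^k - H_k / 4. Finally t^(-k) T_k and
-- t^(-k) S_k are binomial sums in 1/t (Pascal's rule), and the coefficient j/(j+1) C(k+j, 2j+1)
-- comes from k C(k+j, 2j+1) = (j+1) (C(k+j+1, 2j+2) + C(k+j, 2j+2)).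

module Submission where

open import Defs

module DistanceMatrix where

  open import Data.Nat as ℕ using (ℕ; zero; suc; ∣_-_∣)
  import Data.Nat.Properties as ℕ
  open import Data.Integer as ℤ using (+_)
  import Data.Integer.Properties as ℤ
  open import Data.Rational using (ℚ; 0ℚ; 1ℚ; ½; _+_; _*_; _-_; -_; _/_; 1/_; ≢-nonZero; toℚᵘ)
  open import Data.Rational.Base using (+-0-rawMonoid)
  open import Algebra.Definitions.RawMonoid +-0-rawMonoid using () renaming (_×_ to _×ℚ_)
  open import Data.Rational.Solver using (module +-*-Solver)
  open import Data.Rational.Unnormalised as ℚᵘ using (mkℚᵘ; *≡*) renaming (_+_ to _+ᵘ_; _*_ to _*ᵘ_)
  import Data.Rational.Unnormalised.Properties as ℚᵘ
  open import Data.Rational.Properties using (toℚᵘ-injective; toℚᵘ-fromℚᵘ; toℚᵘ-homo-+; toℚᵘ-homo-*)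
  open import Data.Rational.Properties
    using (+-*-commutativeRing; _≟_; +-identityˡ; +-identityʳ; +-comm; +-assoc; *-zeroˡ; *-zeroʳ;
           *-distribˡ-+; *-distribʳ-+; *-assoc; *-identityˡ; *-inverseʳ)
  open import Data.Fin as Fin using (Fin; zero; suc; toℕ; punchIn; punchOut)
  import Data.Fin.Properties as Fin
  open import Data.Sum using (_⊎_; inj₁; inj₂)
  open import Data.Product using (_×_; _,_)
  open import Data.Empty using (⊥-elim)
  open import Function using (_∘_)
  open import Data.Vec.Functional using (updateAt)
  open import Data.Vec.Functional.Properties using (updateAt-updates; updateAt-minimal)
  open import Level using (0ℓ)
  open import Relation.Binary.PropositionalEquality
  open import Relation.Binary.Definitions using (tri<; tri≈; tri>)
  open import Relation.Nullary using (yes; no)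
  open import Relation.Nullary.Decidable using (dec⇒maybe)
  open import Tactic.RingSolver using (solve-∀)
  import Data.Nat.Tactic.RingSolver as ℕ-Solver
  open import Data.Nat.Combinatorics using (_C_; nCk+nC[k+1]≡[n+1]C[k+1]; k>n⇒nCk≡0; nC1≡n)
  open import Tactic.RingSolver.Core.AlmostCommutativeRing using (AlmostCommutativeRing; fromCommutativeRing)

  ℚ-ring : AlmostCommutativeRing 0ℓ 0ℓ
  ℚ-ring = fromCommutativeRing +-*-commutativeRing (λ x → dec⇒maybe (0ℚ ≟ x))

  cong₃ : ∀ {A B C D : Set} (f : A → B → C → D) {x x′ y y′ z z′} →
          x ≡ x′ → y ≡ y′ → z ≡ z′ → f x y z ≡ f x′ y′ z′
  cong₃ f refl refl refl = refl

  toℚᵘ-/ : ∀ n d → toℚᵘ ((+ n) / suc d) ℚᵘ.≃ mkℚᵘ (+ n) d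
  toℚᵘ-/ n d = toℚᵘ-fromℚᵘ (mkℚᵘ (+ n) d)

  ℕ→ℚ-+ : ∀ m n → ℕ→ℚ (m ℕ.+ n) ≡ ℕ→ℚ m + ℕ→ℚ n
  ℕ→ℚ-+ m n = toℚᵘ-injective (begin
    toℚᵘ (ℕ→ℚ (m ℕ.+ n))          ≈⟨ toℚᵘ-/ (m ℕ.+ n) 0 ⟩
    mkℚᵘ (+ (m ℕ.+ n)) 0          ≈⟨ *≡* (cong (ℤ._* + 1) (trans (ℤ.pos-+ m n)
                                          (sym (cong₂ ℤ._+_ (ℤ.*-identityʳ (+ m)) (ℤ.*-identityʳ (+ n)))))) ⟩
    mkℚᵘ (+ m) 0 +ᵘ mkℚᵘ (+ n) 0  ≈⟨ ℚᵘ.+-cong (toℚᵘ-/ m 0) (toℚᵘ-/ n 0) ⟨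
    toℚᵘ (ℕ→ℚ m) +ᵘ toℚᵘ (ℕ→ℚ n)  ≈⟨ toℚᵘ-homo-+ (ℕ→ℚ m) (ℕ→ℚ n) ⟨
    toℚᵘ (ℕ→ℚ m + ℕ→ℚ n)          ∎)
    where open ℚᵘ.≃-Reasoning

  ℕ→ℚ-* : ∀ m n → ℕ→ℚ (m ℕ.* n) ≡ ℕ→ℚ m * ℕ→ℚ n
  ℕ→ℚ-* m n = toℚᵘ-injective (begin
    toℚᵘ (ℕ→ℚ (m ℕ.* n))          ≈⟨ toℚᵘ-/ (m ℕ.* n) 0 ⟩
    mkℚᵘ (+ (m ℕ.* n)) 0          ≈⟨ *≡* (cong (ℤ._* + 1) (ℤ.pos-* m n)) ⟩
    mkℚᵘ (+ m) 0 *ᵘ mkℚᵘ (+ n) 0  ≈⟨ ℚᵘ.*-cong (toℚᵘ-/ m 0) (toℚᵘ-/ n 0) ⟨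
    toℚᵘ (ℕ→ℚ m) *ᵘ toℚᵘ (ℕ→ℚ n)  ≈⟨ toℚᵘ-homo-* (ℕ→ℚ m) (ℕ→ℚ n) ⟨
    toℚᵘ (ℕ→ℚ m * ℕ→ℚ n)          ∎)
    where open ℚᵘ.≃-Reasoning

  ℕ→ℚ-suc : ∀ n → ℕ→ℚ (suc n) ≡ 1ℚ + ℕ→ℚ n
  ℕ→ℚ-suc = ℕ→ℚ-+ 1

  n/d≡n*[1/d] : ∀ n d → (+ n) / suc d ≡ ℕ→ℚ n * ((+ 1) / suc d)
  n/d≡n*[1/d] n d = toℚᵘ-injective (begin
    toℚᵘ ((+ n) / suc d)          ≈⟨ toℚᵘ-/ n d ⟩
    mkℚᵘ (+ n) d                  ≈⟨ *≡* (trans (cong (λ x → + n ℤ.* + suc x) (ℕ.+-identityʳ d))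
                                                (cong (ℤ._* + suc d) (sym (ℤ.*-identityʳ (+ n))))) ⟩
    mkℚᵘ (+ n) 0 *ᵘ mkℚᵘ (+ 1) d  ≈⟨ ℚᵘ.*-cong (toℚᵘ-/ n 0) (toℚᵘ-/ 1 d) ⟨
    toℚᵘ (ℕ→ℚ n) *ᵘ toℚᵘ ((+ 1) / suc d)  ≈⟨ toℚᵘ-homo-* (ℕ→ℚ n) ((+ 1) / suc d) ⟨
    toℚᵘ (ℕ→ℚ n * ((+ 1) / suc d)) ∎)
    where open ℚᵘ.≃-Reasoning

  1/n*n≡1 : ∀ d → ((+ 1) / suc d) * ℕ→ℚ (suc d) ≡ 1ℚ
  1/n*n≡1 d = toℚᵘ-injective (begin
    toℚᵘ (((+ 1) / suc d) * ℕ→ℚ (suc d))  ≈⟨ toℚᵘ-homo-* ((+ 1) / suc d) (ℕ→ℚ (suc d)) ⟩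
    toℚᵘ ((+ 1) / suc d) *ᵘ toℚᵘ (ℕ→ℚ (suc d))  ≈⟨ ℚᵘ.*-cong (toℚᵘ-/ 1 d) (toℚᵘ-/ (suc d) 0) ⟩
    mkℚᵘ (+ 1) d *ᵘ mkℚᵘ (+ suc d) 0      ≈⟨ *≡* (cong (λ x → + suc x)
                                                (trans (ℕ.*-identityʳ (d ℕ.+ 0)) (cong (ℕ._+ 0) (sym (ℕ.*-identityʳ d))))) ⟩
    mkℚᵘ (+ 1) 0                           ≈⟨ toℚᵘ-/ 1 0 ⟨
    toℚᵘ 1ℚ                                ∎)
    where open ℚᵘ.≃-Reasoning

  sumFin-cong : ∀ n {f g : Fin n → ℚ} → (∀ i → f i ≡ g i) → sumFin n f ≡ sumFin n g
  sumFin-cong zero    f≗g = refl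
  sumFin-cong (suc n) f≗g = cong₂ _+_ (f≗g zero) (sumFin-cong n (f≗g ∘ suc))

  sumFin-+ : ∀ n (f g : Fin n → ℚ) → sumFin n (λ i → f i + g i) ≡ sumFin n f + sumFin n g
  sumFin-+ zero    f g = refl
  sumFin-+ (suc n) f g = trans (cong (_+_ (f zero + g zero)) (sumFin-+ n (f ∘ suc) (g ∘ suc)))
                               (interchange (f zero) (g zero) _ _)
    where
    interchange : ∀ a b c d → (a + b) + (c + d) ≡ (a + c) + (b + d)
    interchange = solve-∀ ℚ-ring

  sumFin-* : ∀ n (a : ℚ) (f : Fin n → ℚ) → sumFin n (λ i → a * f i) ≡ a * sumFin n f
  sumFin-* zero    a f = sym (*-zeroʳ a)
  sumFin-* (suc n) a f = trans (cong (_+_ (a * f zero)) (sumFin-* n a (f ∘ suc)))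
                               (sym (*-distribˡ-+ a (f zero) _))

  sumFin-zero : ∀ n {f : Fin n → ℚ} → (∀ i → f i ≡ 0ℚ) → sumFin n f ≡ 0ℚ
  sumFin-zero zero    f≗0 = refl
  sumFin-zero (suc n) f≗0 = cong₂ _+_ (f≗0 zero) (sumFin-zero n (f≗0 ∘ suc))

  sumFin-single : ∀ n (f : Fin n → ℚ) (c : Fin n) → (∀ j → j ≢ c → f j ≡ 0ℚ) → sumFin n f ≡ f c
  sumFin-single (suc n) f zero    off = trans (cong (_+_ (f zero)) (sumFin-zero n (λ i → off (suc i) λ ())))
                                             (+-identityʳ (f zero))
  sumFin-single (suc n) f (suc c) off =
    trans (cong₂ _+_ (off zero λ ()) (sumFin-single n (f ∘ suc) c (λ j j≢c → off (suc j) (j≢c ∘ Fin.suc-injective))))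
          (+-identityˡ (f (suc c)))

  sumFin-pair : ∀ n (f : Fin n → ℚ) {c d : Fin n} → c ≢ d → (∀ j → j ≢ c → j ≢ d → f j ≡ 0ℚ) →
                sumFin n f ≡ f c + f d
  sumFin-pair (suc n) f {zero}  {zero}  c≢d off = ⊥-elim (c≢d refl)
  sumFin-pair (suc n) f {zero}  {suc d} c≢d off =
    cong (_+_ (f zero)) (sumFin-single n (f ∘ suc) d (λ j j≢d → off (suc j) (λ ()) (j≢d ∘ Fin.suc-injective)))
  sumFin-pair (suc n) f {suc c} {zero}  c≢d off =
    trans (cong (_+_ (f zero)) (sumFin-single n (f ∘ suc) c (λ j j≢c → off (suc j) (j≢c ∘ Fin.suc-injective) (λ ()))))
          (+-comm (f zero) (f (suc c)))
  sumFin-pair (suc n) f {suc c} {suc d} c≢d off =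
    trans (cong₂ _+_ (off zero (λ ()) (λ ()))
                     (sumFin-pair n (f ∘ suc) (c≢d ∘ cong suc)
                       (λ j j≢c j≢d → off (suc j) (j≢c ∘ Fin.suc-injective) (j≢d ∘ Fin.suc-injective))))
          (+-identityˡ _)

  sumℕ : ℕ → (ℕ → ℚ) → ℚ
  sumℕ n f = sumFin n (f ∘ toℕ)

  sumℕ-cong : ∀ n {f g : ℕ → ℚ} → (∀ j → f j ≡ g j) → sumℕ n f ≡ sumℕ n g
  sumℕ-cong n f≗g = sumFin-cong n (f≗g ∘ toℕ)

  sumℕ-+ : ∀ n (f g : ℕ → ℚ) → sumℕ n (λ j → f j + g j) ≡ sumℕ n f + sumℕ n g
  sumℕ-+ n f g = sumFin-+ n (f ∘ toℕ) (g ∘ toℕ)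

  sumℕ-* : ∀ n a (f : ℕ → ℚ) → sumℕ n (λ j → a * f j) ≡ a * sumℕ n f
  sumℕ-* n a f = sumFin-* n a (f ∘ toℕ)

  sumℕ-− : ∀ n (f g : ℕ → ℚ) → sumℕ n (λ j → f j - g j) ≡ sumℕ n f - sumℕ n g
  sumℕ-− n f g = begin
    sumℕ n (λ j → f j - g j)              ≡⟨ sumℕ-cong n (λ j → as-sum (f j) (g j)) ⟩
    sumℕ n (λ j → f j + - 1ℚ * g j)       ≡⟨ sumℕ-+ n f (λ j → - 1ℚ * g j) ⟩
    sumℕ n f + sumℕ n (λ j → - 1ℚ * g j)  ≡⟨ cong (_+_ (sumℕ n f)) (sumℕ-* n (- 1ℚ) g) ⟩
    sumℕ n f + - 1ℚ * sumℕ n g            ≡⟨ as-sum (sumℕ n f) (sumℕ n g) ⟨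
    sumℕ n f - sumℕ n g                   ∎
    where
    open ≡-Reasoning
    as-sum : ∀ x y → x - y ≡ x + - 1ℚ * y
    as-sum = solve-∀ ℚ-ring

  sumℕ-snoc : ∀ n f → sumℕ (suc n) f ≡ sumℕ n f + f n
  sumℕ-snoc zero    f = trans (+-identityʳ (f 0)) (sym (+-identityˡ (f 0)))
  sumℕ-snoc (suc n) f = trans (cong (_+_ (f 0)) (sumℕ-snoc n (f ∘ suc))) (sym (+-assoc (f 0) _ (f (suc n))))

  sum1≡sumℕ : ∀ n f → sum1 n f ≡ sumℕ n (f ∘ suc)
  sum1≡sumℕ zero    f = refl
  sum1≡sumℕ (suc n) f = trans (cong (_+ f (suc n)) (sum1≡sumℕ n f)) (sym (sumℕ-snoc n (f ∘ suc)))

  -- Determinants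

  toℕ-punchIn-< : ∀ {n} (i : Fin (suc n)) (x : Fin n) → toℕ x ℕ.< toℕ i → toℕ (punchIn i x) ≡ toℕ x
  toℕ-punchIn-< (suc i) zero    _             = refl
  toℕ-punchIn-< (suc i) (suc x) (ℕ.s≤s x<i) = cong suc (toℕ-punchIn-< i x x<i)

  toℕ-punchIn-≥ : ∀ {n} (i : Fin (suc n)) (x : Fin n) → toℕ i ℕ.≤ toℕ x → toℕ (punchIn i x) ≡ suc (toℕ x)
  toℕ-punchIn-≥ zero    x       _             = refl
  toℕ-punchIn-≥ (suc i) (suc x) (ℕ.s≤s i≤x) = cong suc (toℕ-punchIn-≥ i x i≤x)

  toℕ-punchOut-< : ∀ {n} {i j : Fin (suc n)} (i≢j : i ≢ j) → toℕ j ℕ.< toℕ i → toℕ (punchOut i≢j) ≡ toℕ j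
  toℕ-punchOut-< {suc n} {suc i} {zero}  i≢j _             = refl
  toℕ-punchOut-< {suc n} {suc i} {suc j} i≢j (ℕ.s≤s j<i) = cong suc (toℕ-punchOut-< (i≢j ∘ cong suc) j<i)

  toℕ-punchOut-> : ∀ {n} {i j : Fin (suc n)} (i≢j : i ≢ j) → toℕ i ℕ.< toℕ j → suc (toℕ (punchOut i≢j)) ≡ toℕ j
  toℕ-punchOut-> {n}     {zero}  {suc j} i≢j _             = refl
  toℕ-punchOut-> {suc n} {suc i} {suc j} i≢j (ℕ.s≤s i<j) = cong suc (toℕ-punchOut-> (i≢j ∘ cong suc) i<j)

  adjacent⇒≢ : ∀ {n} {c d : Fin n} → toℕ d ≡ suc (toℕ c) → c ≢ d
  adjacent⇒≢ d≡1+c c≡d = ℕ.1+n≢n (sym (trans (cong toℕ c≡d) d≡1+c))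

  punchIn-adjacent : ∀ {n} {c d : Fin (suc n)} → toℕ d ≡ suc (toℕ c) →
                     ∀ x → punchIn c x ≡ punchIn d x ⊎ (punchIn c x ≡ d × punchIn d x ≡ c)
  punchIn-adjacent {c = c} {d} d≡1+c x with ℕ.<-cmp (toℕ x) (toℕ c)
  ... | tri< x<c _ _ = inj₁ (Fin.toℕ-injective (trans (toℕ-punchIn-< c x x<c) (sym (toℕ-punchIn-< d x x<d))))
    where x<d = ℕ.<-trans x<c (ℕ.≤-reflexive (sym d≡1+c))
  ... | tri≈ _ x≡c _ =
    inj₂ ( Fin.toℕ-injective (trans (toℕ-punchIn-≥ c x (ℕ.≤-reflexive (sym x≡c))) (trans (cong suc x≡c) (sym d≡1+c)))
         , Fin.toℕ-injective (trans (toℕ-punchIn-< d x x<d) x≡c))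
    where x<d = subst (ℕ._< toℕ d) (sym x≡c) (ℕ.≤-reflexive (sym d≡1+c))
  ... | tri> _ _ c<x = inj₁ (Fin.toℕ-injective (trans (toℕ-punchIn-≥ c x (ℕ.<⇒≤ c<x)) (sym (toℕ-punchIn-≥ d x d≤x))))
    where d≤x = subst (ℕ._≤ toℕ x) (sym d≡1+c) c<x

  punchOut-adjacent : ∀ {n} {c d j : Fin (suc n)} → toℕ d ≡ suc (toℕ c) → (j≢c : j ≢ c) (j≢d : j ≢ d) →
                      toℕ (punchOut j≢d) ≡ suc (toℕ (punchOut j≢c))
  punchOut-adjacent {c = c} {d} {j} d≡1+c j≢c j≢d with ℕ.<-cmp (toℕ j) (toℕ c)
  ... | tri< j<c _ _ = ℕ.suc-injective (trans (toℕ-punchOut-> j≢d (ℕ.<-trans j<c c<d))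
                                              (trans d≡1+c (cong suc (sym (toℕ-punchOut-> j≢c j<c)))))
    where c<d = ℕ.≤-reflexive (sym d≡1+c)
  ... | tri≈ _ j≡c _ = ⊥-elim (j≢c (Fin.toℕ-injective j≡c))
  ... | tri> _ _ c<j = trans (toℕ-punchOut-< j≢d d<j) (trans d≡1+c (cong suc (sym (toℕ-punchOut-< j≢c c<j))))
    where d<j = ℕ.≤∧≢⇒< (subst (ℕ._≤ toℕ j) (sym d≡1+c) c<j) (j≢d ∘ Fin.toℕ-injective ∘ sym)

  punchIn-avoids : ∀ {n} {j c : Fin (suc n)} (j≢c : j ≢ c) (x : Fin n) → x ≢ punchOut j≢c → punchIn j x ≢ c
  punchIn-avoids {j = j} j≢c x x≢ eq =
    x≢ (Fin.punchIn-injective j x (punchOut j≢c) (trans eq (sym (Fin.punchIn-punchOut j≢c))))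

  minor : ∀ n → Matrix (suc n) → Fin (suc n) → Matrix n
  minor n M j r c = M (suc r) (punchIn j c)

  row₀-term : ∀ n → Matrix (suc n) → Fin (suc n) → ℚ
  row₀-term n M j = sgn (toℕ j) * (M zero j * det n (minor n M j))

  det-cong : ∀ n {M N : Matrix n} → (∀ i j → M i j ≡ N i j) → det n M ≡ det n N
  det-cong zero    M≗N = refl
  det-cong (suc n) M≗N = sumFin-cong (suc n) λ j →
    cong (_*_ (sgn (toℕ j))) (cong₂ _*_ (M≗N zero j) (det-cong n (λ r c → M≗N (suc r) (punchIn j c))))

  det-linear : ∀ n (M N P : Matrix n) (c : Fin n) (a : ℚ) →
               (∀ r j → j ≢ c → M r j ≡ N r j) → (∀ r j → j ≢ c → N r j ≡ P r j) →
               (∀ r → M r c ≡ N r c + a * P r c) → det n M ≡ det n N + a * det n P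
  det-linear (suc n) M N P c a M≡N N≡P Mc≡ =
    trans (sumFin-cong (suc n) term)
          (trans (sumFin-+ (suc n) (row₀-term n N) (λ j → a * row₀-term n P j))
                 (cong (_+_ (det (suc n) N)) (sumFin-* (suc n) a (row₀-term n P))))
    where
    col-linear : ∀ s x y a D → s * ((x + a * y) * D) ≡ s * (x * D) + a * (s * (y * D))
    col-linear = solve-∀ ℚ-ring
    minor-linear : ∀ s x a D E → s * (x * (D + a * E)) ≡ s * (x * D) + a * (s * (x * E))
    minor-linear = solve-∀ ℚ-ring

    term : ∀ j → row₀-term n M j ≡ row₀-term n N j + a * row₀-term n P j
    term j with j Fin.≟ c
    ... | yes refl = begin
      s * (M zero j * det n (minor n M j))
        ≡⟨ cong₂ (λ x D → s * (x * D)) (Mc≡ zero) (det-cong n (λ r x → M≡N (suc r) (punchIn j x) (Fin.punchInᵢ≢i j x))) ⟩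
      s * ((N zero j + a * P zero j) * det n (minor n N j))
        ≡⟨ col-linear s (N zero j) (P zero j) a (det n (minor n N j)) ⟩
      row₀-term n N j + a * (s * (P zero j * det n (minor n N j)))
        ≡⟨ cong (λ D → row₀-term n N j + a * (s * (P zero j * D)))
                (det-cong n (λ r x → N≡P (suc r) (punchIn j x) (Fin.punchInᵢ≢i j x))) ⟩
      row₀-term n N j + a * row₀-term n P j
        ∎
      where
      open ≡-Reasoning
      s = sgn (toℕ j)
    ... | no j≢c = begin
      s * (M zero j * det n (minor n M j))
        ≡⟨ cong₂ (λ x D → s * (x * D)) (M≡N zero j j≢c) minor-linearity ⟩
      s * (N zero j * (det n (minor n N j) + a * det n (minor n P j)))
        ≡⟨ minor-linear s (N zero j) a (det n (minor n N j)) (det n (minor n P j)) ⟩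
      row₀-term n N j + a * (s * (N zero j * det n (minor n P j)))
        ≡⟨ cong (λ x → row₀-term n N j + a * (s * (x * det n (minor n P j)))) (N≡P zero j j≢c) ⟩
      row₀-term n N j + a * row₀-term n P j
        ∎
      where
      open ≡-Reasoning
      s = sgn (toℕ j)
      minor-linearity = det-linear n (minor n M j) (minor n N j) (minor n P j) (punchOut j≢c) a
        (λ r x x≢ → M≡N (suc r) (punchIn j x) (punchIn-avoids j≢c x x≢))
        (λ r x x≢ → N≡P (suc r) (punchIn j x) (punchIn-avoids j≢c x x≢))
        (λ r → subst (λ y → M (suc r) y ≡ N (suc r) y + a * P (suc r) y) (sym (Fin.punchIn-punchOut j≢c)) (Mc≡ (suc r)))

  det-equal-adjacent-columns : ∀ n (M : Matrix n) {c d : Fin n} → toℕ d ≡ suc (toℕ c) →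
                               (∀ r → M r d ≡ M r c) → det n M ≡ 0ℚ
  det-equal-adjacent-columns (suc n) M {c} {d} d≡1+c Md≡Mc = trans (sumFin-pair (suc n) term c≢d vanish) cancel
    where
    term = row₀-term n M

    c≢d : c ≢ d
    c≢d = adjacent⇒≢ d≡1+c

    vanish : ∀ j → j ≢ c → j ≢ d → term j ≡ 0ℚ
    vanish j j≢c j≢d =
      trans (cong (λ D → sgn (toℕ j) * (M zero j * D)) minor≡0) (zero-factor (sgn (toℕ j)) (M zero j))
      where
      zero-factor : ∀ s x → s * (x * 0ℚ) ≡ 0ℚ
      zero-factor = solve-∀ ℚ-ring
      minor≡0 = det-equal-adjacent-columns n (minor n M j) (punchOut-adjacent d≡1+c j≢c j≢d)
        (λ r → subst₂ (λ y z → M (suc r) y ≡ M (suc r) z)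
                 (sym (Fin.punchIn-punchOut j≢d)) (sym (Fin.punchIn-punchOut j≢c)) (Md≡Mc (suc r)))

    minors-agree : ∀ r x → minor n M c r x ≡ minor n M d r x
    minors-agree r x with punchIn-adjacent d≡1+c x
    ... | inj₁ same           = cong (M (suc r)) same
    ... | inj₂ (c′≡d , d′≡c) = trans (cong (M (suc r)) c′≡d) (trans (Md≡Mc (suc r)) (cong (M (suc r)) (sym d′≡c)))

    cancel : term c + term d ≡ 0ℚ
    cancel = begin
      s * (M zero c * det n (minor n M c)) + sgn (toℕ d) * (M zero d * det n (minor n M d))
        ≡⟨ cong₃ (λ s′ x D → s * (M zero c * D) + s′ * (x * det n (minor n M d)))
                 (cong sgn d≡1+c) (Md≡Mc zero) (det-cong n minors-agree) ⟩
      s * (M zero c * det n (minor n M d)) + (- 1ℚ * s) * (M zero c * det n (minor n M d))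
        ≡⟨ opposite s (M zero c) (det n (minor n M d)) ⟩
      0ℚ
        ∎
      where
      open ≡-Reasoning
      s = sgn (toℕ c)
      opposite : ∀ s x D → s * (x * D) + (- 1ℚ * s) * (x * D) ≡ 0ℚ
      opposite = solve-∀ ℚ-ring

  det-subtract-adjacent-column : ∀ n (M M′ : Matrix n) {c d : Fin n} → toℕ d ≡ suc (toℕ c) →
                                 (∀ r j → j ≢ d → M′ r j ≡ M r j) → (∀ r → M′ r d ≡ M r d - M r c) →
                                 det n M′ ≡ det n M
  det-subtract-adjacent-column n M M′ {c} {d} d≡1+c M′≡M M′d≡ = begin
    det n M′                        ≡⟨ det-linear n M′ M P d (- 1ℚ) M′≡M M≡P M′d≡M+P ⟩
    det n M + - 1ℚ * det n P        ≡⟨ cong (λ D → det n M + - 1ℚ * D) detP≡0 ⟩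
    det n M + - 1ℚ * 0ℚ             ≡⟨ +-identityʳ (det n M) ⟩
    det n M                         ∎
    where
    open ≡-Reasoning
    P : Matrix n
    P r = updateAt (M r) d (λ _ → M r c)
    c≢d : c ≢ d
    c≢d = adjacent⇒≢ d≡1+c
    M≡P : ∀ r j → j ≢ d → M r j ≡ P r j
    M≡P r j j≢d = sym (updateAt-minimal j d (M r) j≢d)
    Pd≡Mc : ∀ r → P r d ≡ M r c
    Pd≡Mc r = updateAt-updates d (M r)
    sub-as-add : ∀ x y → x - y ≡ x + - 1ℚ * y
    sub-as-add = solve-∀ ℚ-ring
    M′d≡M+P : ∀ r → M′ r d ≡ M r d + - 1ℚ * P r d
    M′d≡M+P r = trans (M′d≡ r)
                      (trans (sub-as-add (M r d) (M r c)) (cong (λ x → M r d + - 1ℚ * x) (sym (Pd≡Mc r))))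
    detP≡0 : det n P ≡ 0ℚ
    detP≡0 = det-equal-adjacent-columns n P d≡1+c (λ r → trans (Pd≡Mc r) (sym (updateAt-minimal c d (M r) c≢d)))

  det-1 : ∀ (M : Matrix 1) → det 1 M ≡ M zero zero
  det-1 M = unfolded (M zero zero)
    where
    unfolded : ∀ x → 1ℚ * (x * 1ℚ) + 0ℚ ≡ x
    unfolded = solve-∀ ℚ-ring

  det-2 : ∀ (M : Matrix 2) → det 2 M ≡ M zero zero * M (suc zero) (suc zero) - M zero (suc zero) * M (suc zero) zero
  det-2 M = unfolded (M zero zero) (M zero (suc zero)) (M (suc zero) zero) (M (suc zero) (suc zero))
    where
    unfolded : ∀ a b c d → 1ℚ * (a * (1ℚ * (d * 1ℚ) + 0ℚ)) + ((- 1ℚ * 1ℚ) * (b * (1ℚ * (c * 1ℚ) + 0ℚ)) + 0ℚ)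
                           ≡ a * d - b * c
    unfolded = solve-∀ ℚ-ring

  det-row₀-three : ∀ n (M : Matrix (3 ℕ.+ n)) → (∀ j → M zero (suc (suc (suc j))) ≡ 0ℚ) →
                   det (3 ℕ.+ n) M ≡ M zero zero * det (2 ℕ.+ n) (minor _ M zero)
                                   - M zero (suc zero) * det (2 ℕ.+ n) (minor _ M (suc zero))
                                   + M zero (suc (suc zero)) * det (2 ℕ.+ n) (minor _ M (suc (suc zero)))
  det-row₀-three n M M₀ⱼ≡0 =
    trans (cong (λ x → term zero + (term (suc zero) + (term (suc (suc zero)) + x))) tail≡0)
          (unfolded (M zero zero) (M zero (suc zero)) (M zero (suc (suc zero))) (D zero) (D (suc zero)) (D (suc (suc zero))))
    where
    D : Fin (3 ℕ.+ n) → ℚ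
    D j = det (2 ℕ.+ n) (minor _ M j)
    term = row₀-term (2 ℕ.+ n) M
    zero-factor : ∀ s D → s * (0ℚ * D) ≡ 0ℚ
    zero-factor = solve-∀ ℚ-ring
    tail≡0 : sumFin n (λ j → term (suc (suc (suc j)))) ≡ 0ℚ
    tail≡0 = sumFin-zero n λ j → trans (cong (λ x → sgn (3 ℕ.+ toℕ j) * (x * D (suc (suc (suc j))))) (M₀ⱼ≡0 j))
                                        (zero-factor (sgn (3 ℕ.+ toℕ j)) (D (suc (suc (suc j)))))
    unfolded : ∀ a b c x y z → 1ℚ * (a * x) + ((- 1ℚ * 1ℚ) * (b * y) + ((- 1ℚ * (- 1ℚ * 1ℚ)) * (c * z) + 0ℚ))
                                ≡ a * x - b * y + c * z
    unfolded = solve-∀ ℚ-ring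

  toMatrix : (n : ℕ) → (ℕ → ℕ → ℚ) → Matrix n
  toMatrix n e i j = e (toℕ i) (toℕ j)

  -- diffAfter m x replaces x j by x j - x (j - 1) for every j > m.
  diffAfter : ℕ → (ℕ → ℚ) → ℕ → ℚ
  diffAfter m       x zero    = x zero
  diffAfter zero    x (suc j) = x (suc j) - x j
  diffAfter (suc m) x (suc j) = diffAfter m (x ∘ suc) j

  diffAfter-≤ : ∀ m x j → j ℕ.≤ m → diffAfter m x j ≡ x j
  diffAfter-≤ m       x zero    _            = refl
  diffAfter-≤ (suc m) x (suc j) (ℕ.s≤s j≤m) = diffAfter-≤ m (x ∘ suc) j j≤m

  diffAfter-≢ : ∀ m x j → j ≢ suc m → diffAfter m x j ≡ diffAfter (suc m) x j
  diffAfter-≢ m       x zero          _    = refl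
  diffAfter-≢ zero    x (suc zero)    j≢1  = ⊥-elim (j≢1 refl)
  diffAfter-≢ zero    x (suc (suc j)) _    = refl
  diffAfter-≢ (suc m) x (suc j)       j≢m′ = diffAfter-≢ m (x ∘ suc) j (j≢m′ ∘ cong suc)

  diffAfter-at : ∀ m x → diffAfter m x (suc m) ≡ diffAfter (suc m) x (suc m) - diffAfter (suc m) x m
  diffAfter-at zero    x = refl
  diffAfter-at (suc m) x = diffAfter-at m (x ∘ suc)

  rowsDiffAfter : ℕ → (ℕ → ℕ → ℚ) → ℕ → ℕ → ℚ
  rowsDiffAfter m e i = diffAfter m (e i)

  det-diffAfter-step : ∀ n m e → det n (toMatrix n (rowsDiffAfter m e)) ≡ det n (toMatrix n (rowsDiffAfter (suc m) e))
  det-diffAfter-step n m e with suc m ℕ.<? n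
  ... | yes m+1<n = det-subtract-adjacent-column n (toMatrix n (rowsDiffAfter (suc m) e)) (toMatrix n (rowsDiffAfter m e))
                      {c = Fin.fromℕ< m<n} {d = Fin.fromℕ< m+1<n} (trans d≡m+1 (cong suc (sym c≡m)))
                      (λ r j j≢d → diffAfter-≢ m (e (toℕ r)) (toℕ j) (λ j≡m+1 → j≢d (Fin.toℕ-injective (trans j≡m+1 (sym d≡m+1)))))
                      (λ r → subst₂ (λ p q → diffAfter m (e (toℕ r)) p ≡ diffAfter (suc m) (e (toℕ r)) p - diffAfter (suc m) (e (toℕ r)) q)
                                    (sym d≡m+1) (sym c≡m) (diffAfter-at m (e (toℕ r))))
    where
    m<n = ℕ.<-trans (ℕ.n<1+n m) m+1<n
    d≡m+1 = Fin.toℕ-fromℕ< m+1<n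
    c≡m = Fin.toℕ-fromℕ< m<n
  ... | no m+1≮n = det-cong n λ r j → trans (diffAfter-≤ m (e (toℕ r)) (toℕ j) (j≤m j))
                                            (sym (diffAfter-≤ (suc m) (e (toℕ r)) (toℕ j) (ℕ.m≤n⇒m≤1+n (j≤m j))))
    where
    j≤m : ∀ (j : Fin n) → toℕ j ℕ.≤ m
    j≤m j = ℕ.≤-pred (ℕ.<-≤-trans (Fin.toℕ<n j) (ℕ.≮⇒≥ m+1≮n))

  det-diffAfter : ∀ n m e → det n (toMatrix n (rowsDiffAfter m e)) ≡ det n (toMatrix n e)
  det-diffAfter n m e = trans (steps n) (det-cong n λ r j →
    diffAfter-≤ (n ℕ.+ m) (e (toℕ r)) (toℕ j) (ℕ.≤-trans (ℕ.<⇒≤ (Fin.toℕ<n j)) (ℕ.m≤m+n n m)))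
    where
    steps : ∀ s → det n (toMatrix n (rowsDiffAfter m e)) ≡ det n (toMatrix n (rowsDiffAfter (s ℕ.+ m) e))
    steps zero    = refl
    steps (suc s) = trans (steps s) (det-diffAfter-step n (s ℕ.+ m) e)

  -- The matrix A_k - tI after differencing

  δ : ℕ → ℕ → ℚ
  δ zero    zero    = 1ℚ
  δ zero    (suc _) = 0ℚ
  δ (suc _) zero    = 0ℚ
  δ (suc i) (suc j) = δ i j

  I≡δ : ∀ k (r c : Fin k) → I k r c ≡ δ (toℕ r) (toℕ c)
  I≡δ k r c with toℕ r ℕ.≟ toℕ c
  ... | yes r≡c = sym (subst (λ j → δ (toℕ r) j ≡ 1ℚ) r≡c (δ-refl (toℕ r)))
    where
    δ-refl : ∀ i → δ i i ≡ 1ℚ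
    δ-refl zero    = refl
    δ-refl (suc i) = δ-refl i
  ... | no r≢c = sym (δ-≢ (toℕ r) (toℕ c) r≢c)
    where
    δ-≢ : ∀ i j → i ≢ j → δ i j ≡ 0ℚ
    δ-≢ zero    zero    i≢j = ⊥-elim (i≢j refl)
    δ-≢ zero    (suc j) _   = refl
    δ-≢ (suc i) zero    _   = refl
    δ-≢ (suc i) (suc j) i≢j = δ-≢ i j (i≢j ∘ cong suc)

  half : ℕ → ℚ
  half n = (+ n) / 2

  half-suc : ∀ n → half (suc n) ≡ ½ + half n
  half-suc n = begin
    half (suc n)              ≡⟨ n/d≡n*[1/d] (suc n) 1 ⟩
    ℕ→ℚ (suc n) * ½           ≡⟨ cong (_* ½) (ℕ→ℚ-suc n) ⟩
    (1ℚ + ℕ→ℚ n) * ½          ≡⟨ *-distribʳ-+ ½ 1ℚ (ℕ→ℚ n) ⟩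
    1ℚ * ½ + ℕ→ℚ n * ½        ≡⟨ cong₂ _+_ (*-identityˡ ½) (sym (n/d≡n*[1/d] n 1)) ⟩
    ½ + half n                ∎
    where open ≡-Reasoning

  |-|-second-difference : ∀ i j → (half ∣ i - suc (suc j) ∣ - half ∣ i - suc j ∣) - (half ∣ i - suc j ∣ - half ∣ i - j ∣)
                                  ≡ δ i (suc j)
  |-|-second-difference zero          j       =
    trans (cong₂ (λ x y → (x - y) - (y - half j)) (trans (half-suc (suc j)) (cong (_+_ ½) (half-suc j))) (half-suc j))
          (flat ½ (half j))
    where
    flat : ∀ x h → ((x + (x + h)) - (x + h)) - ((x + h) - h) ≡ 0ℚ
    flat = solve-∀ ℚ-ring
  |-|-second-difference (suc zero)    zero    = refl
  |-|-second-difference (suc (suc i)) zero    =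
    trans (cong₂ (λ x y → (x - y) - (y - half (suc (suc i)))) (cong half (ℕ.∣-∣-identityʳ i)) (half-suc i))
          (trans (cong (λ x → (half i - (½ + half i)) - ((½ + half i) - x)) (trans (half-suc (suc i)) (cong (_+_ ½) (half-suc i))))
                 (flat ½ (half i)))
    where
    flat : ∀ x h → (h - (x + h)) - ((x + h) - (x + (x + h))) ≡ 0ℚ
    flat = solve-∀ ℚ-ring
  |-|-second-difference (suc i)       (suc j) = |-|-second-difference i j

  two : ℚ
  two = 1ℚ + 1ℚ

  ¼ : ℚ
  ¼ = (+ 1) / 4

  -- Polynomial syntax for the sequences below, unfolded j steps above a level n whose values
  -- are the variables t, T n, S n, (-1)^n, t^n and n; `solve` can then check recurrences that
  -- hold only after unfolding. H₁ₚ j and G′₁ₚ j stand for H and G′ at level n + j + 1, since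
  -- their value at level n is not determined by those variables.
  module Unfolding {k : ℕ} (t T S s p N : +-*-Solver.Polynomial k) where
    open +-*-Solver

    βₚ : Polynomial k
    βₚ = con 1ℚ :+ con two :* t

    Tₚ Sₚ sgnₚ powₚ natₚ Gₚ H₁ₚ G′₁ₚ : ℕ → Polynomial k
    Tₚ zero    = T
    Tₚ (suc j) = t :* Tₚ j :+ Sₚ j
    Sₚ zero    = S
    Sₚ (suc j) = t :* Sₚ j :+ Tₚ (suc j)
    sgnₚ zero    = s
    sgnₚ (suc j) = con (- 1ℚ) :* sgnₚ j
    powₚ zero    = p
    powₚ (suc j) = t :* powₚ j
    natₚ zero    = N
    natₚ (suc j) = con 1ℚ :+ natₚ j
    Gₚ j = :- (sgnₚ j :* (Sₚ j :- powₚ j))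
    H₁ₚ j = sgnₚ (suc j) :* (natₚ (suc j) :* Tₚ (suc j) :- Sₚ (suc j) :- t :* Sₚ j :+ con two :* powₚ (suc j))
    G′₁ₚ j = H₁ₚ (suc j) :+ t :* H₁ₚ j :- Gₚ (suc j)

  module _ (t : ℚ) where

    β : ℚ
    β = 1ℚ + two * t

    band : ℕ → ℕ → ℚ
    band i j = (- t) * δ i j + β * δ (suc i) j + (- t) * δ (suc (suc i)) j

    band₀ band₁ : ℕ → ℚ
    band₀ i = band i 0
    band₁ i = band i 1

    twoCols : (ℕ → ℚ) → (ℕ → ℚ) → ℕ → ℕ → ℚ
    twoCols u v i zero          = u i
    twoCols u v i (suc zero)    = v i
    twoCols u v i (suc (suc j)) = band i (suc (suc j))

    D₂ : ℕ → (ℕ → ℚ) → (ℕ → ℚ) → ℚ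
    D₂ n u v = det n (toMatrix n (twoCols u v))

    D₁ : ℕ → (ℕ → ℚ) → ℚ
    D₁ n w = D₂ n w band₁

    band-0-1 : band 0 1 ≡ β
    band-0-1 = lemma (- t) β
      where
      lemma : ∀ a b → a * 0ℚ + b * 1ℚ + a * 0ℚ ≡ b
      lemma = solve-∀ ℚ-ring

    band-1-1 : band 1 1 ≡ - t
    band-1-1 = lemma (- t) β
      where
      lemma : ∀ a b → a * 1ℚ + b * 0ℚ + a * 0ℚ ≡ a
      lemma = solve-∀ ℚ-ring

    band-0-2 : band 0 2 ≡ - t
    band-0-2 = lemma (- t) β
      where
      lemma : ∀ a b → a * 0ℚ + b * 0ℚ + a * 1ℚ ≡ a
      lemma = solve-∀ ℚ-ring

    band-0-far : ∀ j → band 0 (3 ℕ.+ j) ≡ 0ℚ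
    band-0-far j = lemma (- t) β
      where
      lemma : ∀ a b → a * 0ℚ + b * 0ℚ + a * 0ℚ ≡ 0ℚ
      lemma = solve-∀ ℚ-ring

    D₂-expand : ∀ n u v → D₂ (3 ℕ.+ n) u v ≡ u 0 * D₁ (2 ℕ.+ n) (v ∘ suc) - v 0 * D₁ (2 ℕ.+ n) (u ∘ suc)
                                              + (- t) * D₂ (2 ℕ.+ n) (u ∘ suc) (v ∘ suc)
    D₂-expand n u v = trans (det-row₀-three n M (band-0-far ∘ toℕ))
      (cong₂ _+_ (cong₂ _-_ (cong (_*_ (u 0)) minor₀) (cong (_*_ (v 0)) minor₁)) (cong₂ _*_ band-0-2 minor₂))
      where
      M = toMatrix (3 ℕ.+ n) (twoCols u v)
      minor₀ : det (2 ℕ.+ n) (minor _ M zero) ≡ D₁ (2 ℕ.+ n) (v ∘ suc)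
      minor₀ = det-cong _ {minor _ M zero} {toMatrix _ (twoCols (v ∘ suc) band₁)}
                 λ { r zero → refl ; r (suc zero) → refl ; r (suc (suc x)) → refl }
      minor₁ : det (2 ℕ.+ n) (minor _ M (suc zero)) ≡ D₁ (2 ℕ.+ n) (u ∘ suc)
      minor₁ = det-cong _ {minor _ M (suc zero)} {toMatrix _ (twoCols (u ∘ suc) band₁)}
                 λ { r zero → refl ; r (suc zero) → refl ; r (suc (suc x)) → refl }
      minor₂ : det (2 ℕ.+ n) (minor _ M (suc (suc zero))) ≡ D₂ (2 ℕ.+ n) (u ∘ suc) (v ∘ suc)
      minor₂ = det-cong _ {minor _ M (suc (suc zero))} {toMatrix _ (twoCols (u ∘ suc) (v ∘ suc))}
                 λ { r zero → refl ; r (suc zero) → refl ; r (suc (suc x)) → refl }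

    D₁-expand : ∀ n w → D₁ (3 ℕ.+ n) w ≡ w 0 * D₁ (2 ℕ.+ n) band₀ - β * D₁ (2 ℕ.+ n) (w ∘ suc)
                                           + (- t) * D₂ (2 ℕ.+ n) (w ∘ suc) band₀
    D₁-expand n w = trans (D₂-expand n w band₁)
      (cong (λ x → w 0 * D₁ (2 ℕ.+ n) band₀ - x * D₁ (2 ℕ.+ n) (w ∘ suc) + (- t) * D₂ (2 ℕ.+ n) (w ∘ suc) band₀)
            band-0-1)

    D₂-2 : ∀ u v → D₂ 2 u v ≡ u 0 * v 1 - v 0 * u 1
    D₂-2 u v = det-2 (toMatrix 2 (twoCols u v))

    D₁-1 : ∀ w → D₁ 1 w ≡ w 0
    D₁-1 w = det-1 (toMatrix 1 (twoCols w band₁))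

    D₁-2 : ∀ w → D₁ 2 w ≡ w 0 * (- t) - β * w 1
    D₁-2 w = trans (D₂-2 w band₁) (cong₂ (λ x y → w 0 * x - y * w 1) band-1-1 band-0-1)

    T S : ℕ → ℚ
    T zero    = 0ℚ
    T (suc k) = t * T k + S k
    S zero    = 1ℚ
    S (suc k) = t * S k + T (suc k)

    -- By D₁-affine and D₂-affine, G n, G′ n and H n are D₁ n 1, D₁ n i and D₂ n 1 i.
    G : ℕ → ℚ
    G m = - (sgn m * (S m - pow t m))

    H : ℕ → ℚ
    H zero    = 0ℚ
    H (suc m) = sgn (suc m) * ((suc m ×ℚ 1ℚ) * T (suc m) - S (suc m) - t * S m + two * pow t (suc m))

    G′ : ℕ → ℚ
    G′ m = H (suc m) + t * H m - G m

    pow-neg : ∀ n → pow (- t) n ≡ sgn n * pow t n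
    pow-neg zero    = refl
    pow-neg (suc n) = trans (cong (_*_ (- t)) (pow-neg n)) (lemma t (sgn n) (pow t n))
      where
      lemma : ∀ τ s p → (- τ) * (s * p) ≡ (- 1ℚ * s) * (τ * p)
      lemma = solve-∀ ℚ-ring

    open +-*-Solver using (solve; _:=_; _:+_; _:-_; _:*_; :-_; con)

    G-rec : ∀ n → G (3 ℕ.+ n) ≡ (- t) * ((- t) * pow (- t) n) - β * G (2 ℕ.+ n) - t * t * G (1 ℕ.+ n)
    G-rec n = trans
      (solve 6 (λ τ T S s p N → let open Unfolding τ T S s p N in
                  Gₚ 3 := (:- τ) :* ((:- τ) :* (s :* p)) :- βₚ :* Gₚ 2 :- τ :* τ :* Gₚ 1)
               refl t (T n) (S n) (sgn n) (pow t n) (n ×ℚ 1ℚ))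
      (cong (λ q → (- t) * ((- t) * q) - β * G (2 ℕ.+ n) - t * t * G (1 ℕ.+ n)) (sym (pow-neg n)))

    G′-rec : ∀ n → G′ (3 ℕ.+ n) ≡ - (β * (G (2 ℕ.+ n) + G′ (2 ℕ.+ n)))
                                   - t * t * (two * G (1 ℕ.+ n) + G′ (1 ℕ.+ n))
    G′-rec n = solve 6 (λ τ T S s p N → let open Unfolding τ T S s p N in
                          G′₁ₚ 2 := :- (βₚ :* (Gₚ 2 :+ G′₁ₚ 1)) :- τ :* τ :* (con two :* Gₚ 1 :+ G′₁ₚ 0))
                       refl t (T n) (S n) (sgn n) (pow t n) (n ×ℚ 1ℚ)

    G′-via-H : ∀ n → G′ (2 ℕ.+ n) ≡ - (t * (two * G (1 ℕ.+ n) + G′ (1 ℕ.+ n))) - H (2 ℕ.+ n)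
    G′-via-H n = solve 6 (λ τ T S s p N → let open Unfolding τ T S s p N in
                         G′₁ₚ 1 := :- (τ :* (con two :* Gₚ 1 :+ G′₁ₚ 0)) :- H₁ₚ 1)
                      refl t (T n) (S n) (sgn n) (pow t n) (n ×ℚ 1ℚ)

    H-rec : ∀ m → H (suc m) ≡ G m + G′ m - t * H m
    H-rec m = lemma t (H (suc m)) (H m) (G m)
      where
      lemma : ∀ τ h₁ h₀ g → h₁ ≡ g + (h₁ + τ * h₀ - g) - τ * h₀
      lemma = solve-∀ ℚ-ring

    G-1 : G 1 ≡ 1ℚ
    G-1 = solve 1 (λ τ → let open Unfolding τ (con 0ℚ) (con 1ℚ) (con 1ℚ) (con 1ℚ) (con 0ℚ) in
                      Gₚ 1 := con 1ℚ) refl t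

    G′-1 : G′ 1 ≡ 0ℚ
    G′-1 = solve 1 (λ τ → let open Unfolding τ (con 0ℚ) (con 1ℚ) (con 1ℚ) (con 1ℚ) (con 0ℚ) in
                      G′₁ₚ 0 := con 0ℚ) refl t

    G-2 : G 2 ≡ - t - β
    G-2 = solve 1 (λ τ → let open Unfolding τ (con 0ℚ) (con 1ℚ) (con 1ℚ) (con 1ℚ) (con 0ℚ) in
                      Gₚ 2 := :- τ :- βₚ) refl t

    G′-2 : G′ 2 ≡ - β
    G′-2 = solve 1 (λ τ → let open Unfolding τ (con 0ℚ) (con 1ℚ) (con 1ℚ) (con 1ℚ) (con 0ℚ) in
                      G′₁ₚ 1 := :- βₚ) refl t

    H-2 : H 2 ≡ 1ℚ
    H-2 = solve 1 (λ τ → let open Unfolding τ (con 0ℚ) (con 1ℚ) (con 1ℚ) (con 1ℚ) (con 0ℚ) in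
                      H₁ₚ 1 := con 1ℚ) refl t

    affine : ℚ → ℚ → ℚ → ℕ → ℚ
    affine a b g i = a + b * ℕ→ℚ i + g * δ i 0

    affine-0 : ∀ a b g → affine a b g 0 ≡ a + g
    affine-0 a b g = lemma a b g
      where
      lemma : ∀ a b g → a + b * 0ℚ + g * 1ℚ ≡ a + g
      lemma = solve-∀ ℚ-ring

    affine-1 : ∀ a b g → affine a b g 1 ≡ a + b
    affine-1 a b g = lemma a b g
      where
      lemma : ∀ a b g → a + b * 1ℚ + g * 0ℚ ≡ a + b
      lemma = solve-∀ ℚ-ring

    affine-shift : ∀ {w : ℕ → ℚ} a b g → (∀ i → w i ≡ affine a b g i) → ∀ i → w (suc i) ≡ affine (a + b) b 0ℚ i
    affine-shift {w} a b g w≗ i = trans (w≗ (suc i))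
      (trans (cong (λ x → a + b * x + g * 0ℚ) (ℕ→ℚ-suc i)) (lemma a b g (ℕ→ℚ i) (δ i 0)))
      where
      lemma : ∀ a b g n d → a + b * (1ℚ + n) + g * 0ℚ ≡ (a + b) + b * n + 0ℚ * d
      lemma = solve-∀ ℚ-ring

    band₀-affine : ∀ i → band₀ i ≡ affine 0ℚ 0ℚ (- t) i
    band₀-affine i = lemma t β (δ i 0) (ℕ→ℚ i)
      where
      lemma : ∀ τ b d n → (- τ) * d + b * 0ℚ + (- τ) * 0ℚ ≡ 0ℚ + 0ℚ * n + (- τ) * d
      lemma = solve-∀ ℚ-ring

    Γ : ℕ → ℚ → ℚ → ℚ
    Γ n a b = a * G n + b * G′ n

    D₁-affine : ∀ n w a b g → (∀ i → w i ≡ affine a b g i) → D₁ (suc n) w ≡ Γ (suc n) a b + g * pow (- t) n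
    D₂-affine : ∀ n u v a b g a′ b′ g′ → (∀ i → u i ≡ affine a b g i) → (∀ i → v i ≡ affine a′ b′ g′ i) →
                D₂ (2 ℕ.+ n) u v ≡ (a * b′ - a′ * b) * H (2 ℕ.+ n) + g * Γ (suc n) (a′ + b′) b′ - g′ * Γ (suc n) (a + b) b
    D₁-linear : ∀ n w a b → (∀ i → w i ≡ affine a b 0ℚ i) → D₁ (suc n) w ≡ Γ (suc n) a b
    D₂-linear : ∀ n u v a b a′ b′ → (∀ i → u i ≡ affine a b 0ℚ i) → (∀ i → v i ≡ affine a′ b′ 0ℚ i) →
                D₂ (2 ℕ.+ n) u v ≡ (a * b′ - a′ * b) * H (2 ℕ.+ n)
    D₁-band₀ : ∀ n → D₁ (suc n) band₀ ≡ pow (- t) (suc n)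
    D₂-band₀ : ∀ n w a b → (∀ i → w i ≡ affine a b 0ℚ i) → D₂ (2 ℕ.+ n) w band₀ ≡ t * Γ (suc n) (a + b) b

    D₁-linear n w a b w≗ = trans (D₁-affine n w a b 0ℚ w≗) (lemma (Γ (suc n) a b) (pow (- t) n))
      where
      lemma : ∀ x q → x + 0ℚ * q ≡ x
      lemma = solve-∀ ℚ-ring

    D₂-linear n u v a b a′ b′ u≗ v≗ = trans (D₂-affine n u v a b 0ℚ a′ b′ 0ℚ u≗ v≗)
      (lemma ((a * b′ - a′ * b) * H (2 ℕ.+ n)) (Γ (suc n) (a′ + b′) b′) (Γ (suc n) (a + b) b))
      where
      lemma : ∀ x y z → x + 0ℚ * y - 0ℚ * z ≡ x
      lemma = solve-∀ ℚ-ring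

    D₁-band₀ n = trans (D₁-affine n band₀ 0ℚ 0ℚ (- t) band₀-affine) (lemma t (G (suc n)) (G′ (suc n)) (pow (- t) n))
      where
      lemma : ∀ τ x y q → 0ℚ * x + 0ℚ * y + (- τ) * q ≡ (- τ) * q
      lemma = solve-∀ ℚ-ring

    D₂-band₀ n w a b w≗ = trans (D₂-affine n w band₀ a b 0ℚ 0ℚ 0ℚ (- t) w≗ band₀-affine)
      (lemma t a b (H (2 ℕ.+ n)) (Γ (suc n) (0ℚ + 0ℚ) 0ℚ) (G (suc n)) (G′ (suc n)))
      where
      lemma : ∀ τ a b h x g g′ → (a * 0ℚ - 0ℚ * b) * h + 0ℚ * x - (- τ) * ((a + b) * g + b * g′)
                                  ≡ τ * ((a + b) * g + b * g′)
      lemma = solve-∀ ℚ-ring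

    D₁-affine zero w a b g w≗ = begin
      D₁ 1 w                                ≡⟨ D₁-1 w ⟩
      w 0                                   ≡⟨ trans (w≗ 0) (affine-0 a b g) ⟩
      a + g                                 ≡⟨ lemma a b g ⟩
      a * 1ℚ + b * 0ℚ + g * 1ℚ              ≡⟨ cong₂ (λ x y → a * x + b * y + g * 1ℚ) (sym G-1) (sym G′-1) ⟩
      Γ 1 a b + g * pow (- t) 0             ∎
      where
      open ≡-Reasoning
      lemma : ∀ a b g → a + g ≡ a * 1ℚ + b * 0ℚ + g * 1ℚ
      lemma = solve-∀ ℚ-ring
    D₁-affine (suc zero) w a b g w≗ = begin
      D₁ 2 w
        ≡⟨ D₁-2 w ⟩
      w 0 * (- t) - β * w 1
        ≡⟨ cong₂ (λ x y → x * (- t) - β * y) (trans (w≗ 0) (affine-0 a b g)) (trans (w≗ 1) (affine-1 a b g)) ⟩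
      (a + g) * (- t) - β * (a + b)
        ≡⟨ lemma t β a b g ⟩
      a * (- t - β) + b * (- β) + g * pow (- t) 1
        ≡⟨ cong₂ (λ x y → a * x + b * y + g * pow (- t) 1) (sym G-2) (sym G′-2) ⟩
      Γ 2 a b + g * pow (- t) 1
        ∎
      where
      open ≡-Reasoning
      lemma : ∀ τ β a b g → (a + g) * (- τ) - β * (a + b) ≡ a * (- τ - β) + b * (- β) + g * ((- τ) * 1ℚ)
      lemma = solve-∀ ℚ-ring
    D₁-affine (suc (suc n)) w a b g w≗ = begin
      D₁ (3 ℕ.+ n) w
        ≡⟨ D₁-expand n w ⟩
      w 0 * D₁ (2 ℕ.+ n) band₀ - β * D₁ (2 ℕ.+ n) (w ∘ suc) + (- t) * D₂ (2 ℕ.+ n) (w ∘ suc) band₀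
        ≡⟨ cong₂ _+_ (cong₂ _-_ (cong₂ _*_ (trans (w≗ 0) (affine-0 a b g)) (D₁-band₀ (suc n)))
                                (cong (_*_ β) (D₁-linear (suc n) (w ∘ suc) (a + b) b w′≗)))
                     (cong (_*_ (- t)) (D₂-band₀ n (w ∘ suc) (a + b) b w′≗)) ⟩
      (a + g) * pow (- t) (2 ℕ.+ n) - β * Γ (2 ℕ.+ n) (a + b) b + (- t) * (t * Γ (suc n) (a + b + b) b)
        ≡⟨ collect t a b g (pow (- t) n) (G (suc n)) (G (2 ℕ.+ n)) (G′ (suc n)) (G′ (2 ℕ.+ n)) ⟩
      a * ((- t) * ((- t) * pow (- t) n) - β * G (2 ℕ.+ n) - t * t * G (1 ℕ.+ n))
        + b * (- (β * (G (2 ℕ.+ n) + G′ (2 ℕ.+ n))) - t * t * (two * G (1 ℕ.+ n) + G′ (1 ℕ.+ n)))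
        + g * pow (- t) (2 ℕ.+ n)
        ≡⟨ cong₂ (λ x y → a * x + b * y + g * pow (- t) (2 ℕ.+ n)) (sym (G-rec n)) (sym (G′-rec n)) ⟩
      Γ (3 ℕ.+ n) a b + g * pow (- t) (2 ℕ.+ n)
        ∎
      where
      open ≡-Reasoning
      w′≗ = affine-shift a b g w≗
      collect : ∀ τ a b g q g₁ g₂ g′₁ g′₂ →
        (a + g) * ((- τ) * ((- τ) * q)) - (1ℚ + two * τ) * ((a + b) * g₂ + b * g′₂)
          + (- τ) * (τ * ((a + b + b) * g₁ + b * g′₁))
          ≡ a * ((- τ) * ((- τ) * q) - (1ℚ + two * τ) * g₂ - τ * τ * g₁)
            + b * (- ((1ℚ + two * τ) * (g₂ + g′₂)) - τ * τ * (two * g₁ + g′₁)) + g * ((- τ) * ((- τ) * q))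
      collect = solve-∀ ℚ-ring

    D₂-affine zero u v a b g a′ b′ g′ u≗ v≗ = begin
      D₂ 2 u v
        ≡⟨ D₂-2 u v ⟩
      u 0 * v 1 - v 0 * u 1
        ≡⟨ cong₂ _-_ (cong₂ _*_ (trans (u≗ 0) (affine-0 a b g)) (trans (v≗ 1) (affine-1 a′ b′ g′)))
                     (cong₂ _*_ (trans (v≗ 0) (affine-0 a′ b′ g′)) (trans (u≗ 1) (affine-1 a b g))) ⟩
      (a + g) * (a′ + b′) - (a′ + g′) * (a + b)
        ≡⟨ lemma a b g a′ b′ g′ ⟩
      (a * b′ - a′ * b) * 1ℚ + g * ((a′ + b′) * 1ℚ + b′ * 0ℚ) - g′ * ((a + b) * 1ℚ + b * 0ℚ)
        ≡⟨ cong₃ (λ h x y → (a * b′ - a′ * b) * h + g * ((a′ + b′) * x + b′ * y) - g′ * ((a + b) * x + b * y))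
                 (sym H-2) (sym G-1) (sym G′-1) ⟩
      (a * b′ - a′ * b) * H 2 + g * Γ 1 (a′ + b′) b′ - g′ * Γ 1 (a + b) b
        ∎
      where
      open ≡-Reasoning
      lemma : ∀ a b g a′ b′ g′ →
              (a + g) * (a′ + b′) - (a′ + g′) * (a + b)
                ≡ (a * b′ - a′ * b) * 1ℚ + g * ((a′ + b′) * 1ℚ + b′ * 0ℚ) - g′ * ((a + b) * 1ℚ + b * 0ℚ)
      lemma = solve-∀ ℚ-ring
    D₂-affine (suc n) u v a b g a′ b′ g′ u≗ v≗ = begin
      D₂ (3 ℕ.+ n) u v
        ≡⟨ D₂-expand n u v ⟩
      u 0 * D₁ (2 ℕ.+ n) (v ∘ suc) - v 0 * D₁ (2 ℕ.+ n) (u ∘ suc) + (- t) * D₂ (2 ℕ.+ n) (u ∘ suc) (v ∘ suc)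
        ≡⟨ cong₂ _+_ (cong₂ _-_ (cong₂ _*_ (trans (u≗ 0) (affine-0 a b g)) (D₁-linear (suc n) (v ∘ suc) (a′ + b′) b′ v′≗))
                                (cong₂ _*_ (trans (v≗ 0) (affine-0 a′ b′ g′)) (D₁-linear (suc n) (u ∘ suc) (a + b) b u′≗)))
                     (cong (_*_ (- t)) (D₂-linear n (u ∘ suc) (v ∘ suc) (a + b) b (a′ + b′) b′ u′≗ v′≗)) ⟩
      (a + g) * Γ (2 ℕ.+ n) (a′ + b′) b′ - (a′ + g′) * Γ (2 ℕ.+ n) (a + b) b
        + (- t) * (((a + b) * b′ - (a′ + b′) * b) * H (2 ℕ.+ n))
        ≡⟨ collect t a b g a′ b′ g′ (G (2 ℕ.+ n)) (G′ (2 ℕ.+ n)) (H (2 ℕ.+ n)) ⟩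
      (a * b′ - a′ * b) * (G (2 ℕ.+ n) + G′ (2 ℕ.+ n) - t * H (2 ℕ.+ n))
        + g * Γ (2 ℕ.+ n) (a′ + b′) b′ - g′ * Γ (2 ℕ.+ n) (a + b) b
        ≡⟨ cong (λ h → (a * b′ - a′ * b) * h + g * Γ (2 ℕ.+ n) (a′ + b′) b′ - g′ * Γ (2 ℕ.+ n) (a + b) b)
                (sym (H-rec (2 ℕ.+ n))) ⟩
      (a * b′ - a′ * b) * H (3 ℕ.+ n) + g * Γ (2 ℕ.+ n) (a′ + b′) b′ - g′ * Γ (2 ℕ.+ n) (a + b) b
        ∎
      where
      open ≡-Reasoning
      u′≗ = affine-shift a b g u≗
      v′≗ = affine-shift a′ b′ g′ v≗
      collect : ∀ τ a b g a′ b′ g′ g₂ g′₂ h₂ →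
        (a + g) * ((a′ + b′) * g₂ + b′ * g′₂) - (a′ + g′) * ((a + b) * g₂ + b * g′₂)
          + (- τ) * (((a + b) * b′ - (a′ + b′) * b) * h₂)
          ≡ (a * b′ - a′ * b) * (g₂ + g′₂ - τ * h₂)
            + g * ((a′ + b′) * g₂ + b′ * g′₂) - g′ * ((a + b) * g₂ + b * g′₂)
      collect = solve-∀ ℚ-ring

    entry : ℕ → ℕ → ℚ
    entry i j = half ∣ i - j ∣ - t * δ i j

    entry-second-difference : ∀ i j → (entry i (suc (suc j)) - entry i (suc j)) - (entry i (suc j) - entry i j)
                                      ≡ band i (suc (suc j))
    entry-second-difference i j =
      trans (split (half ∣ i - suc (suc j) ∣) (half ∣ i - suc j ∣) (half ∣ i - j ∣)
                   (δ i (suc (suc j))) (δ i (suc j)) (δ i j) t)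
            (trans (cong (λ x → x + ((- t) * δ i (suc (suc j)) + (two * t) * δ i (suc j) + (- t) * δ i j))
                         (|-|-second-difference i j))
                   (merge (δ i (suc (suc j))) (δ i (suc j)) (δ i j) t))
      where
      split : ∀ x₂ x₁ x₀ d₂ d₁ d₀ τ →
              ((x₂ - τ * d₂) - (x₁ - τ * d₁)) - ((x₁ - τ * d₁) - (x₀ - τ * d₀))
              ≡ ((x₂ - x₁) - (x₁ - x₀)) + ((- τ) * d₂ + (two * τ) * d₁ + (- τ) * d₀)
      split = solve-∀ ℚ-ring
      merge : ∀ d₂ d₁ d₀ τ → d₁ + ((- τ) * d₂ + (two * τ) * d₁ + (- τ) * d₀)
                             ≡ (- τ) * d₂ + (1ℚ + two * τ) * d₁ + (- τ) * d₀
      merge = solve-∀ ℚ-ring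

    col₀ col₁ : ℕ → ℚ
    col₀ i = entry i 0
    col₁ i = entry i 1 - entry i 0

    twice-differenced : ∀ i j → rowsDiffAfter 1 (rowsDiffAfter 0 entry) i j ≡ twoCols col₀ col₁ i j
    twice-differenced i zero          = refl
    twice-differenced i (suc zero)    = refl
    twice-differenced i (suc (suc j)) = entry-second-difference i j

    charPoly≡D₂ : ∀ k → charPoly k t ≡ D₂ k col₀ col₁
    charPoly≡D₂ k = begin
      charPoly k t
        ≡⟨ det-cong k (λ r c → cong (λ x → half ∣ toℕ r - toℕ c ∣ - t * x) (I≡δ k r c)) ⟩
      det k (toMatrix k entry)
        ≡⟨ det-diffAfter k 0 entry ⟨
      det k (toMatrix k (rowsDiffAfter 0 entry))
        ≡⟨ det-diffAfter k 1 (rowsDiffAfter 0 entry) ⟨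
      det k (toMatrix k (rowsDiffAfter 1 (rowsDiffAfter 0 entry)))
        ≡⟨ det-cong k (λ r c → twice-differenced (toℕ r) (toℕ c)) ⟩
      D₂ k col₀ col₁
        ∎
      where open ≡-Reasoning

    col₀-0 : col₀ 0 ≡ - t
    col₀-0 = lemma t
      where
      lemma : ∀ τ → 0ℚ - τ * 1ℚ ≡ - τ
      lemma = solve-∀ ℚ-ring

    col₁-0 : col₁ 0 ≡ ½ + t
    col₁-0 = lemma t
      where
      lemma : ∀ τ → (½ - τ * 0ℚ) - (0ℚ - τ * 1ℚ) ≡ ½ + τ
      lemma = solve-∀ ℚ-ring

    col₀-suc : ∀ i → col₀ (suc i) ≡ affine ½ ½ 0ℚ i
    col₀-suc i = trans (cong (λ x → x - t * 0ℚ) (trans (n/d≡n*[1/d] (suc i) 1) (cong (_* ½) (ℕ→ℚ-suc i))))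
                       (lemma (ℕ→ℚ i) t (δ i 0))
      where
      lemma : ∀ n τ d → (1ℚ + n) * ½ - τ * 0ℚ ≡ ½ + ½ * n + 0ℚ * d
      lemma = solve-∀ ℚ-ring

    col₁-suc : ∀ i → col₁ (suc i) ≡ affine (- ½) 0ℚ (- t) i
    col₁-suc zero    = lemma t
      where
      lemma : ∀ τ → (0ℚ - τ * 1ℚ) - (½ - τ * 0ℚ) ≡ - ½ + 0ℚ * 0ℚ + (- τ) * 1ℚ
      lemma = solve-∀ ℚ-ring
    col₁-suc (suc i) =
      trans (cong₂ (λ x y → (x - t * 0ℚ) - (y - t * 0ℚ)) (half-suc i) (trans (half-suc (suc i)) (cong (_+_ ½) (half-suc i))))
            (lemma (half i) t (ℕ→ℚ (suc i)))
      where
      lemma : ∀ h τ n → ((½ + h) - τ * 0ℚ) - ((½ + (½ + h)) - τ * 0ℚ) ≡ - ½ + 0ℚ * n + (- τ) * 0ℚ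
      lemma = solve-∀ ℚ-ring

    charPoly≡H : ∀ n → charPoly (2 ℕ.+ n) t ≡ pow (- t) (2 ℕ.+ n) - ¼ * H (2 ℕ.+ n)
    charPoly≡H zero = begin
      charPoly 2 t
        ≡⟨ charPoly≡D₂ 2 ⟩
      D₂ 2 col₀ col₁
        ≡⟨ D₂-2 col₀ col₁ ⟩
      col₀ 0 * col₁ 1 - col₁ 0 * col₀ 1
        ≡⟨ cong₂ _-_ (cong₂ _*_ col₀-0 (col₁-suc 0)) (cong₂ _*_ col₁-0 (col₀-suc 0)) ⟩
      (- t) * affine (- ½) 0ℚ (- t) 0 - (½ + t) * affine ½ ½ 0ℚ 0
        ≡⟨ lemma t ⟩
      pow (- t) 2 - ¼ * 1ℚ
        ≡⟨ cong (λ h → pow (- t) 2 - ¼ * h) (sym H-2) ⟩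
      pow (- t) 2 - ¼ * H 2
        ∎
      where
      open ≡-Reasoning
      lemma : ∀ τ → (- τ) * (- ½ + 0ℚ * 0ℚ + (- τ) * 1ℚ) - (½ + τ) * (½ + ½ * 0ℚ + 0ℚ * 1ℚ)
                    ≡ (- τ) * ((- τ) * 1ℚ) - ¼ * 1ℚ
      lemma = solve-∀ ℚ-ring
    charPoly≡H (suc m) = begin
      charPoly (3 ℕ.+ m) t
        ≡⟨ charPoly≡D₂ (3 ℕ.+ m) ⟩
      D₂ (3 ℕ.+ m) col₀ col₁
        ≡⟨ D₂-expand m col₀ col₁ ⟩
      col₀ 0 * D₁ (2 ℕ.+ m) (col₁ ∘ suc) - col₁ 0 * D₁ (2 ℕ.+ m) (col₀ ∘ suc)
        + (- t) * D₂ (2 ℕ.+ m) (col₀ ∘ suc) (col₁ ∘ suc)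
        ≡⟨ cong₂ _+_ (cong₂ _-_ (cong₂ _*_ col₀-0 (D₁-affine (suc m) (col₁ ∘ suc) (- ½) 0ℚ (- t) col₁-suc))
                                (cong₂ _*_ col₁-0 (D₁-linear (suc m) (col₀ ∘ suc) ½ ½ col₀-suc)))
                     (cong (_*_ (- t)) (D₂-affine m (col₀ ∘ suc) (col₁ ∘ suc) ½ ½ 0ℚ (- ½) 0ℚ (- t) col₀-suc col₁-suc)) ⟩
      (- t) * (Γ (2 ℕ.+ m) (- ½) 0ℚ + (- t) * pow (- t) (suc m)) - (½ + t) * Γ (2 ℕ.+ m) ½ ½
        + (- t) * ((½ * 0ℚ - (- ½) * ½) * H (2 ℕ.+ m) + 0ℚ * Γ (suc m) (- ½ + 0ℚ) 0ℚ - (- t) * Γ (suc m) (½ + ½) ½)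
        ≡⟨ collect t (pow (- t) m) (G (suc m)) (G (2 ℕ.+ m)) (G′ (suc m)) (G′ (2 ℕ.+ m)) (H (2 ℕ.+ m)) (G′-via-H m) ⟩
      pow (- t) (3 ℕ.+ m) - ¼ * (G (2 ℕ.+ m) + G′ (2 ℕ.+ m) - t * H (2 ℕ.+ m))
        ≡⟨ cong (λ h → pow (- t) (3 ℕ.+ m) - ¼ * h) (sym (H-rec (2 ℕ.+ m))) ⟩
      pow (- t) (3 ℕ.+ m) - ¼ * H (3 ℕ.+ m)
        ∎
      where
      open ≡-Reasoning
      collect : ∀ τ q g₁ g₂ g′₁ g′₂ h₂ → g′₂ ≡ - (τ * (two * g₁ + g′₁)) - h₂ →
        (- τ) * ((- ½ * g₂ + 0ℚ * g′₂) + (- τ) * ((- τ) * q)) - (½ + τ) * (½ * g₂ + ½ * g′₂)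
          + (- τ) * ((½ * 0ℚ - (- ½) * ½) * h₂ + 0ℚ * ((- ½ + 0ℚ) * g₁ + 0ℚ * g′₁) - (- τ) * ((½ + ½) * g₁ + ½ * g′₁))
          ≡ (- τ) * ((- τ) * ((- τ) * q)) - ¼ * (g₂ + g′₂ - τ * h₂)
      collect τ q g₁ g₂ g′₁ _ h₂ refl = identity τ q g₁ g₂ g′₁ h₂
        where
        identity : ∀ τ q g₁ g₂ g′₁ h₂ → let g′₂ = - (τ * (two * g₁ + g′₁)) - h₂ in
          (- τ) * ((- ½ * g₂ + 0ℚ * g′₂) + (- τ) * ((- τ) * q)) - (½ + τ) * (½ * g₂ + ½ * g′₂)
            + (- τ) * ((½ * 0ℚ - (- ½) * ½) * h₂ + 0ℚ * ((- ½ + 0ℚ) * g₁ + 0ℚ * g′₁) - (- τ) * ((½ + ½) * g₁ + ½ * g′₁))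
            ≡ (- τ) * ((- τ) * ((- τ) * q)) - ¼ * (g₂ + g′₂ - τ * h₂)
        identity = solve-∀ ℚ-ring

  -- Binomial sums

  [k+1]*[n+1]C[k+1]≡[n+1]*nCk : ∀ n k → suc k ℕ.* (suc n C suc k) ≡ suc n ℕ.* (n C k)
  [k+1]*[n+1]C[k+1]≡[n+1]*nCk zero    zero    = refl
  [k+1]*[n+1]C[k+1]≡[n+1]*nCk zero    (suc k) = ℕ.*-zeroʳ (suc (suc k))
  [k+1]*[n+1]C[k+1]≡[n+1]*nCk (suc n) zero    =
    trans (ℕ.+-identityʳ _) (trans (nC1≡n (suc (suc n))) (sym (ℕ.*-identityʳ (suc (suc n)))))
  [k+1]*[n+1]C[k+1]≡[n+1]*nCk (suc n) (suc k) = begin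
    suc (suc k) ℕ.* (suc (suc n) C suc (suc k))
      ≡⟨ cong (suc (suc k) ℕ.*_) (nCk+nC[k+1]≡[n+1]C[k+1] (suc n) (suc k)) ⟨
    suc (suc k) ℕ.* ((suc n C suc k) ℕ.+ (suc n C suc (suc k)))
      ≡⟨ spread k (suc n C suc k) (suc n C suc (suc k)) ⟩
    suc k ℕ.* (suc n C suc k) ℕ.+ (suc n C suc k) ℕ.+ suc (suc k) ℕ.* (suc n C suc (suc k))
      ≡⟨ cong₂ (λ x y → x ℕ.+ (suc n C suc k) ℕ.+ y)
               ([k+1]*[n+1]C[k+1]≡[n+1]*nCk n k) ([k+1]*[n+1]C[k+1]≡[n+1]*nCk n (suc k)) ⟩
    suc n ℕ.* (n C k) ℕ.+ (suc n C suc k) ℕ.+ suc n ℕ.* (n C suc k)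
      ≡⟨ gather n (n C k) (n C suc k) (suc n C suc k) ⟩
    suc n ℕ.* ((n C k) ℕ.+ (n C suc k)) ℕ.+ (suc n C suc k)
      ≡⟨ cong (λ x → suc n ℕ.* x ℕ.+ (suc n C suc k)) (nCk+nC[k+1]≡[n+1]C[k+1] n k) ⟩
    suc n ℕ.* (suc n C suc k) ℕ.+ (suc n C suc k)
      ≡⟨ ℕ.+-comm (suc n ℕ.* (suc n C suc k)) (suc n C suc k) ⟩
    suc (suc n) ℕ.* (suc n C suc k)
      ∎
    where
    open ≡-Reasoning
    spread : ∀ k x y → suc (suc k) ℕ.* (x ℕ.+ y) ≡ suc k ℕ.* x ℕ.+ x ℕ.+ suc (suc k) ℕ.* y
    spread = ℕ-Solver.solve-∀
    gather : ∀ n x y z → suc n ℕ.* x ℕ.+ z ℕ.+ suc n ℕ.* y ≡ suc n ℕ.* (x ℕ.+ y) ℕ.+ z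
    gather = ℕ-Solver.solve-∀

  binomial-weight : ∀ k j → k ℕ.* ((k ℕ.+ j) C suc (2 ℕ.* j))
                            ≡ suc j ℕ.* (suc (k ℕ.+ j) C suc (suc (2 ℕ.* j)) ℕ.+ (k ℕ.+ j) C suc (suc (2 ℕ.* j)))
  binomial-weight k j = ℕ.+-cancelʳ-≡ (suc j ℕ.* a) _ _ (begin
    k ℕ.* a ℕ.+ suc j ℕ.* a                ≡⟨ merge k j a ⟩
    suc (k ℕ.+ j) ℕ.* a                    ≡⟨ [k+1]*[n+1]C[k+1]≡[n+1]*nCk (k ℕ.+ j) (suc (2 ℕ.* j)) ⟨
    suc (suc (2 ℕ.* j)) ℕ.* b              ≡⟨ double j b ⟩
    suc j ℕ.* (b ℕ.+ b)                    ≡⟨ cong (λ x → suc j ℕ.* (b ℕ.+ x)) (nCk+nC[k+1]≡[n+1]C[k+1] (k ℕ.+ j) (suc (2 ℕ.* j))) ⟨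
    suc j ℕ.* (b ℕ.+ (a ℕ.+ c))            ≡⟨ split j a b c ⟩
    suc j ℕ.* (b ℕ.+ c) ℕ.+ suc j ℕ.* a    ∎)
    where
    open ≡-Reasoning
    a = (k ℕ.+ j) C suc (2 ℕ.* j)
    b = suc (k ℕ.+ j) C suc (suc (2 ℕ.* j))
    c = (k ℕ.+ j) C suc (suc (2 ℕ.* j))
    merge : ∀ k j a → k ℕ.* a ℕ.+ suc j ℕ.* a ≡ suc (k ℕ.+ j) ℕ.* a
    merge = ℕ-Solver.solve-∀
    double : ∀ j b → suc (suc (2 ℕ.* j)) ℕ.* b ≡ suc j ℕ.* (b ℕ.+ b)
    double = ℕ-Solver.solve-∀
    split : ∀ j a b c → suc j ℕ.* (b ℕ.+ (a ℕ.+ c)) ≡ suc j ℕ.* (b ℕ.+ c) ℕ.+ suc j ℕ.* a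
    split = ℕ-Solver.solve-∀

  Cq : ℕ → ℕ → ℚ
  Cq n r = ℕ→ℚ (n C r)

  Cq-pascal : ∀ n r → Cq (suc n) (suc r) ≡ Cq n r + Cq n (suc r)
  Cq-pascal n r = trans (cong ℕ→ℚ (sym (nCk+nC[k+1]≡[n+1]C[k+1] n r))) (ℕ→ℚ-+ (n C r) (n C suc r))

  Cq[1+k+k,2+2k]≡0 : ∀ k → Cq (suc (k ℕ.+ k)) (suc (suc (2 ℕ.* k))) ≡ 0ℚ
  Cq[1+k+k,2+2k]≡0 k = cong ℕ→ℚ (k>n⇒nCk≡0 (ℕ.s≤s (ℕ.s≤s (ℕ.≤-reflexive (cong (k ℕ.+_) (sym (ℕ.+-identityʳ k)))))))

  Cq[k+k,1+2k]≡0 : ∀ k → Cq (k ℕ.+ k) (suc (2 ℕ.* k)) ≡ 0ℚ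
  Cq[k+k,1+2k]≡0 k = cong ℕ→ℚ (k>n⇒nCk≡0 (ℕ.s≤s (ℕ.≤-reflexive (cong (k ℕ.+_) (sym (ℕ.+-identityʳ k))))))

  ×ℚ≡ℕ→ℚ : ∀ n → n ×ℚ 1ℚ ≡ ℕ→ℚ n
  ×ℚ≡ℕ→ℚ zero    = refl
  ×ℚ≡ℕ→ℚ (suc n) = trans (cong (_+_ 1ℚ) (×ℚ≡ℕ→ℚ n)) (sym (ℕ→ℚ-suc n))

  module _ (t : ℚ) (t≢0 : t ≢ 0ℚ) where

    u : ℚ
    u = 1/_ t {{≢-nonZero t≢0}}

    X Y : ℕ → ℚ
    X k = sumℕ k (λ j → Cq (k ℕ.+ j) (suc (2 ℕ.* j)) * pow u (suc j))
    Y k = sumℕ (suc k) (λ j → Cq (k ℕ.+ j) (2 ℕ.* j) * pow u j)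

    Y-tail : ∀ k → Y k ≡ 1ℚ + sumℕ k (λ j → Cq (suc (k ℕ.+ j)) (suc (suc (2 ℕ.* j))) * pow u (suc j))
    Y-tail k = cong (_+_ 1ℚ) (sumℕ-cong k λ j → cong (_* pow u (suc j)) (cong₂ Cq (ℕ.+-suc k j) (ℕ.*-suc 2 j)))

    X-suc : ∀ k → X (suc k) ≡ X k + u * Y k
    X-suc k = begin
      X (suc k)
        ≡⟨ sumℕ-cong (suc k) (λ j → trans (cong (_* pow u (suc j)) (Cq-pascal (k ℕ.+ j) (2 ℕ.* j)))
                                          (split u (Cq (k ℕ.+ j) (2 ℕ.* j)) (Cq (k ℕ.+ j) (suc (2 ℕ.* j))) (pow u j))) ⟩
      sumℕ (suc k) (λ j → u * y j + x j)
        ≡⟨ sumℕ-+ (suc k) (λ j → u * y j) x ⟩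
      sumℕ (suc k) (λ j → u * y j) + sumℕ (suc k) x
        ≡⟨ cong₂ _+_ (sumℕ-* (suc k) u y) (sumℕ-snoc k x) ⟩
      u * Y k + (X k + x k)
        ≡⟨ cong (λ c → u * Y k + (X k + c * pow u (suc k))) (Cq[k+k,1+2k]≡0 k) ⟩
      u * Y k + (X k + 0ℚ * pow u (suc k))
        ≡⟨ tidy (u * Y k) (X k) (pow u (suc k)) ⟩
      X k + u * Y k
        ∎
      where
      open ≡-Reasoning
      x y : ℕ → ℚ
      x j = Cq (k ℕ.+ j) (suc (2 ℕ.* j)) * pow u (suc j)
      y j = Cq (k ℕ.+ j) (2 ℕ.* j) * pow u j
      split : ∀ u a b p → (a + b) * (u * p) ≡ u * (a * p) + b * (u * p)
      split = solve-∀ ℚ-ring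
      tidy : ∀ y x p → y + (x + 0ℚ * p) ≡ x + y
      tidy = solve-∀ ℚ-ring

    Y-suc : ∀ k → Y (suc k) ≡ Y k + X (suc k)
    Y-suc k = begin
      Y (suc k)
        ≡⟨ Y-tail (suc k) ⟩
      1ℚ + sumℕ (suc k) (λ j → Cq (suc (suc k ℕ.+ j)) (suc (suc (2 ℕ.* j))) * pow u (suc j))
        ≡⟨ cong (_+_ 1ℚ) (sumℕ-cong (suc k) pascal) ⟩
      1ℚ + sumℕ (suc k) (λ j → x j + y j)
        ≡⟨ cong (_+_ 1ℚ) (trans (sumℕ-+ (suc k) x y) (cong (_+_ (X (suc k))) (sumℕ-snoc k y))) ⟩
      1ℚ + (X (suc k) + (sumℕ k y + y k))
        ≡⟨ cong (λ c → 1ℚ + (X (suc k) + (sumℕ k y + c * pow u (suc k)))) (Cq[1+k+k,2+2k]≡0 k) ⟩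
      1ℚ + (X (suc k) + (sumℕ k y + 0ℚ * pow u (suc k)))
        ≡⟨ tidy (X (suc k)) (sumℕ k y) (pow u (suc k)) ⟩
      (1ℚ + sumℕ k y) + X (suc k)
        ≡⟨ cong (_+ X (suc k)) (Y-tail k) ⟨
      Y k + X (suc k)
        ∎
      where
      open ≡-Reasoning
      x y : ℕ → ℚ
      x j = Cq (suc k ℕ.+ j) (suc (2 ℕ.* j)) * pow u (suc j)
      y j = Cq (suc (k ℕ.+ j)) (suc (suc (2 ℕ.* j))) * pow u (suc j)
      pascal : ∀ j → Cq (suc (suc k ℕ.+ j)) (suc (suc (2 ℕ.* j))) * pow u (suc j) ≡ x j + y j
      pascal j = trans (cong (_* pow u (suc j)) (Cq-pascal (suc (k ℕ.+ j)) (suc (2 ℕ.* j))))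
                       (*-distribʳ-+ (pow u (suc j)) (Cq (suc k ℕ.+ j) (suc (2 ℕ.* j))) (Cq (suc (k ℕ.+ j)) (suc (suc (2 ℕ.* j)))))
      tidy : ∀ x s p → 1ℚ + (x + (s + 0ℚ * p)) ≡ (1ℚ + s) + x
      tidy = solve-∀ ℚ-ring

    tu≡1 : t * u ≡ 1ℚ
    tu≡1 = *-inverseʳ t {{≢-nonZero t≢0}}

    T≡tᵏX : ∀ k → T t k ≡ pow t k * X k
    S≡tᵏY : ∀ k → S t k ≡ pow t k * Y k
    T≡tᵏX zero    = sym (*-zeroʳ 1ℚ)
    T≡tᵏX (suc k) = begin
      t * T t k + S t k                            ≡⟨ cong₂ (λ x y → t * x + y) (T≡tᵏX k) (S≡tᵏY k) ⟩
      t * (pow t k * X k) + pow t k * Y k          ≡⟨ cong (_+_ (t * (pow t k * X k))) (*-identityˡ (pow t k * Y k)) ⟨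
      t * (pow t k * X k) + 1ℚ * (pow t k * Y k)   ≡⟨ cong (λ c → t * (pow t k * X k) + c * (pow t k * Y k)) tu≡1 ⟨
      t * (pow t k * X k) + t * u * (pow t k * Y k) ≡⟨ collect t u (pow t k) (X k) (Y k) ⟩
      t * pow t k * (X k + u * Y k)                ≡⟨ cong (_*_ (t * pow t k)) (X-suc k) ⟨
      pow t (suc k) * X (suc k)                    ∎
      where
      open ≡-Reasoning
      collect : ∀ t u p x y → t * (p * x) + t * u * (p * y) ≡ t * p * (x + u * y)
      collect = solve-∀ ℚ-ring
    S≡tᵏY zero    = refl
    S≡tᵏY (suc k) = begin
      t * S t k + T t (suc k)                      ≡⟨ cong₂ (λ x y → t * x + y) (S≡tᵏY k) (T≡tᵏX (suc k)) ⟩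
      t * (pow t k * Y k) + t * pow t k * X (suc k) ≡⟨ collect t (pow t k) (Y k) (X (suc k)) ⟩
      t * pow t k * (Y k + X (suc k))              ≡⟨ cong (_*_ (t * pow t k)) (Y-suc k) ⟨
      pow t (suc k) * Y (suc k)                    ∎
      where
      open ≡-Reasoning
      collect : ∀ t p y x → t * (p * y) + t * p * x ≡ t * p * (y + x)
      collect = solve-∀ ℚ-ring

    F : ℕ → ℕ → ℚ
    F k j = ((+ j) / suc j) * ℕ→ℚ ((k ℕ.+ j) C (2 ℕ.* j ℕ.+ 1)) * pow u (j ℕ.+ 1)

    k*F-split : ∀ k j → ℕ→ℚ k * F k j
                       ≡ ℕ→ℚ k * (Cq (k ℕ.+ j) (suc (2 ℕ.* j)) * pow u (suc j))
                         - Cq (suc (k ℕ.+ j)) (suc (suc (2 ℕ.* j))) * pow u (suc j)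
                         - Cq (k ℕ.+ j) (suc (suc (2 ℕ.* j))) * pow u (suc j)
    k*F-split k j = begin
      k′ * F k j
        ≡⟨ cong₃ (λ r c q → k′ * (r * c * pow u q))
                 (n/d≡n*[1/d] j j) (cong (Cq (k ℕ.+ j)) (ℕ.+-comm (2 ℕ.* j) 1)) (ℕ.+-comm j 1) ⟩
      k′ * (j′ * w * a * p)
        ≡⟨ regroup k′ j′ w a p ⟩
      j′ * w * (k′ * a) * p
        ≡⟨ cong (λ x → j′ * w * x * p) ka≡[j+1][b+c] ⟩
      j′ * w * (ℕ→ℚ (suc j) * (b + c)) * p
        ≡⟨ regroup′ j′ w (ℕ→ℚ (suc j)) (b + c) p ⟩
      j′ * (w * ℕ→ℚ (suc j)) * (b + c) * p
        ≡⟨ cong (λ x → j′ * x * (b + c) * p) (1/n*n≡1 j) ⟩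
      j′ * 1ℚ * (b + c) * p
        ≡⟨ cancel j′ b c p ⟨
      (1ℚ + j′) * (b + c) * p - b * p - c * p
        ≡⟨ cong (λ x → x * (b + c) * p - b * p - c * p) (ℕ→ℚ-suc j) ⟨
      ℕ→ℚ (suc j) * (b + c) * p - b * p - c * p
        ≡⟨ cong (λ x → x * p - b * p - c * p) ka≡[j+1][b+c] ⟨
      k′ * a * p - b * p - c * p
        ≡⟨ cong (λ x → x - b * p - c * p) (*-assoc k′ a p) ⟩
      k′ * (a * p) - b * p - c * p
        ∎
      where
      open ≡-Reasoning
      k′ = ℕ→ℚ k
      j′ = ℕ→ℚ j
      w = (+ 1) / suc j
      a = Cq (k ℕ.+ j) (suc (2 ℕ.* j))
      b = Cq (suc (k ℕ.+ j)) (suc (suc (2 ℕ.* j)))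
      c = Cq (k ℕ.+ j) (suc (suc (2 ℕ.* j)))
      p = pow u (suc j)
      ka≡[j+1][b+c] : k′ * a ≡ ℕ→ℚ (suc j) * (b + c)
      ka≡[j+1][b+c] = begin
        k′ * a                                  ≡⟨ ℕ→ℚ-* k ((k ℕ.+ j) C suc (2 ℕ.* j)) ⟨
        ℕ→ℚ (k ℕ.* ((k ℕ.+ j) C suc (2 ℕ.* j))) ≡⟨ cong ℕ→ℚ (binomial-weight k j) ⟩
        ℕ→ℚ (suc j ℕ.* (b′ ℕ.+ c′))             ≡⟨ trans (ℕ→ℚ-* (suc j) (b′ ℕ.+ c′)) (cong (_*_ (ℕ→ℚ (suc j))) (ℕ→ℚ-+ b′ c′)) ⟩
        ℕ→ℚ (suc j) * (b + c)                   ∎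
        where
        b′ = suc (k ℕ.+ j) C suc (suc (2 ℕ.* j))
        c′ = (k ℕ.+ j) C suc (suc (2 ℕ.* j))
      regroup : ∀ k j w a p → k * (j * w * a * p) ≡ j * w * (k * a) * p
      regroup = solve-∀ ℚ-ring
      regroup′ : ∀ j w n s p → j * w * (n * s) * p ≡ j * (w * n) * s * p
      regroup′ = solve-∀ ℚ-ring
      cancel : ∀ j b c p → (1ℚ + j) * (b + c) * p - b * p - c * p ≡ j * 1ℚ * (b + c) * p
      cancel = solve-∀ ℚ-ring

    Y-tail-sum : ∀ k → sumℕ k (λ j → Cq (suc (k ℕ.+ j)) (suc (suc (2 ℕ.* j))) * pow u (suc j)) ≡ Y k - 1ℚ
    Y-tail-sum k = trans (lemma (sumℕ k (λ j → Cq (suc (k ℕ.+ j)) (suc (suc (2 ℕ.* j))) * pow u (suc j))))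
                         (cong (_- 1ℚ) (sym (Y-tail k)))
      where
      lemma : ∀ s → s ≡ (1ℚ + s) - 1ℚ
      lemma = solve-∀ ℚ-ring

    k*ΣF-split : ∀ m → ℕ→ℚ (suc m) * sum1 m (F (suc m)) ≡ ℕ→ℚ (suc m) * X (suc m) - (Y (suc m) - 1ℚ) - (Y m - 1ℚ)
    k*ΣF-split m = begin
      k′ * sum1 m (F k)
        ≡⟨ cong (_*_ k′) (trans (sum1≡sumℕ m (F k))
                                (sym (trans (cong (_+ sumℕ m (F k ∘ suc)) F-0) (+-identityˡ (sumℕ m (F k ∘ suc)))))) ⟩
      k′ * sumℕ (suc m) (F k)
        ≡⟨ sumℕ-* (suc m) k′ (F k) ⟨
      sumℕ (suc m) (λ j → k′ * F k j)
        ≡⟨ sumℕ-cong (suc m) (k*F-split k) ⟩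
      sumℕ (suc m) (λ j → k′ * x j - y j - z j)
        ≡⟨ trans (sumℕ-− (suc m) (λ j → k′ * x j - y j) z)
                 (cong (_- sumℕ (suc m) z) (sumℕ-− (suc m) (λ j → k′ * x j) y)) ⟩
      sumℕ (suc m) (λ j → k′ * x j) - sumℕ (suc m) y - sumℕ (suc m) z
        ≡⟨ cong₃ (λ a b c → a - b - c) (sumℕ-* (suc m) k′ x) (Y-tail-sum k) z-sum ⟩
      k′ * X k - (Y k - 1ℚ) - (Y m - 1ℚ)
        ∎
      where
      open ≡-Reasoning
      k = suc m
      k′ = ℕ→ℚ k
      x y z : ℕ → ℚ
      x j = Cq (k ℕ.+ j) (suc (2 ℕ.* j)) * pow u (suc j)
      y j = Cq (suc (k ℕ.+ j)) (suc (suc (2 ℕ.* j))) * pow u (suc j)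
      z j = Cq (k ℕ.+ j) (suc (suc (2 ℕ.* j))) * pow u (suc j)
      F-0 : F k 0 ≡ 0ℚ
      F-0 = trans (cong (_* pow u 1) (*-zeroˡ (ℕ→ℚ ((k ℕ.+ 0) C 1)))) (*-zeroˡ (pow u 1))
      z-sum : sumℕ (suc m) z ≡ Y m - 1ℚ
      z-sum = begin
        sumℕ (suc m) z                    ≡⟨ sumℕ-snoc m z ⟩
        sumℕ m z + z m                    ≡⟨ cong (λ c → sumℕ m z + c * pow u (suc m)) (Cq[1+k+k,2+2k]≡0 m) ⟩
        sumℕ m z + 0ℚ * pow u (suc m)     ≡⟨ cong (_+_ (sumℕ m z)) (*-zeroˡ (pow u (suc m))) ⟩
        sumℕ m z + 0ℚ                     ≡⟨ +-identityʳ (sumℕ m z) ⟩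
        sumℕ m z                          ≡⟨ Y-tail-sum m ⟩
        Y m - 1ℚ                          ∎

    H-as-sum : ∀ m → H t (suc m) ≡ sgn (suc m) * (pow t (suc m) * (ℕ→ℚ (suc m) * sum1 m (F (suc m))))
    H-as-sum m = cong (_*_ (sgn (suc m))) (begin
      (suc m ×ℚ 1ℚ) * T t (suc m) - S t (suc m) - t * S t m + two * p
        ≡⟨ cong₃ (λ x y z → x - y - t * z + two * p)
                 (cong₂ _*_ (×ℚ≡ℕ→ℚ (suc m)) (T≡tᵏX (suc m))) (S≡tᵏY (suc m)) (S≡tᵏY m) ⟩
      k′ * (p * X (suc m)) - p * Y (suc m) - t * (pow t m * Y m) + two * p
        ≡⟨ factor t (pow t m) k′ (X (suc m)) (Y (suc m)) (Y m) ⟩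
      p * (k′ * X (suc m) - (Y (suc m) - 1ℚ) - (Y m - 1ℚ))
        ≡⟨ cong (_*_ p) (k*ΣF-split m) ⟨
      p * (k′ * sum1 m (F (suc m)))
        ∎)
      where
      open ≡-Reasoning
      p = pow t (suc m)
      k′ = ℕ→ℚ (suc m)
      factor : ∀ τ p k x y y′ → k * ((τ * p) * x) - (τ * p) * y - τ * (p * y′) + two * (τ * p)
                                ≡ (τ * p) * (k * x - (y - 1ℚ) - (y′ - 1ℚ))
      factor = solve-∀ ℚ-ring

  sgn-pow-factor : ∀ s p k x → s * p - ¼ * (s * (p * (k * x))) ≡ s * p * (1ℚ - k * ¼ * x)
  sgn-pow-factor = solve-∀ ℚ-ring

open import Data.Nat using (ℕ; suc; _≤_; _∸_; _+_) renaming (_*_ to _ℕ*_)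
open import Data.Nat using (s≤s; z≤n)
open import Data.Nat.Combinatorics using (_C_)
open import Data.Integer using (+_)
open import Data.Rational using (ℚ; 0ℚ; 1ℚ; _*_; _-_; _/_; 1/_; ≢-nonZero)
open import Data.Rational using (-_)
open import Relation.Binary.PropositionalEquality using (_≡_; _≢_)
open import Relation.Binary.PropositionalEquality using (cong; cong₂; sym; module ≡-Reasoning)
open DistanceMatrix using (¼; H; F; pow-neg; charPoly≡H; H-as-sum; n/d≡n*[1/d]; sgn-pow-factor)

theorem2p2 : (k : ℕ) → 2 ≤ k → (t : ℚ) → (t≢0 : t ≢ 0ℚ) →
    charPoly k t ≡ sgn k * pow t k * (1ℚ - ((+ k) / 4) * sum1 (k ∸ 1) (λ j →
    ((+ j) / suc j) * ℕ→ℚ ((k + j) C (2 ℕ* j + 1)) * pow (1/_ t {{≢-nonZero t≢0}}) (j + 1)))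
theorem2p2 .(suc (suc n)) (s≤s (s≤s (z≤n {n}))) t t≢0 = begin
  charPoly k t
    ≡⟨ charPoly≡H t n ⟩
  pow (- t) k - ¼ * H t k
    ≡⟨ cong₂ (λ x y → x - ¼ * y) (pow-neg t k) (H-as-sum t t≢0 (suc n)) ⟩
  sgn k * pow t k - ¼ * (sgn k * (pow t k * (ℕ→ℚ k * Σ)))
    ≡⟨ sgn-pow-factor (sgn k) (pow t k) (ℕ→ℚ k) Σ ⟩
  sgn k * pow t k * (1ℚ - ℕ→ℚ k * ¼ * Σ)
    ≡⟨ cong (λ r → sgn k * pow t k * (1ℚ - r * Σ)) (sym (n/d≡n*[1/d] k 3)) ⟩
  sgn k * pow t k * (1ℚ - ((+ k) / 4) * Σ)
    ∎
  where
  open ≡-Reasoning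
  k = suc (suc n)
  Σ = sum1 (suc n) (F t t≢0 k)
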